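{- Let $k_1\geq 3$ be an odd integer. Then $fsmp(T_{k_1,4})=3$ and $fmp(T_{k_1,4})=4$.
   Context: The $2$-dimensional torus $T_{k_1,k_2}$ has vertex set $\{(x_1,x_2):0\leq x_i\leq k_i-1\}$, two vertices being adjacent iff they differ in exactly one coordinate $i$ and there the difference is $\pm1 \pmod{k_i}$. A fractional perfect matching of $G$ is $g:E(G)\to[0,1]$ with $\sum_{e\ni v}g(e)=1$ for all $v$. $fmp(G)$ (resp. $fsmp(G)$) is the minimum size of a set $F\subseteq E(G)$ (resp. $F\subseteq V(G)\cup E(G)$) whose deletion (vertices with incident edges, and edges) leaves a graph with no fractional perfect matching.
   Formalization: The weights of a fractional perfect matching are taken in the rationals in [0,1] rather than the real interval [0,1]. -}

module Defs where

open import Data.Nat using (ℕ; zero; suc; _+_; _*_; _<_; _≤_)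
open import Data.Fin using (Fin; toℕ)
open import Data.Product using (Σ; ∃; _×_; _,_; proj₁; proj₂)
open import Data.Sum using (_⊎_)
open import Data.List using (List; []; length; allFin; cartesianProduct; map; foldr)
open import Data.List.Membership.Propositional using (_∈_; _∉_)
open import Data.List.Relation.Unary.Any using (Any)
open import Data.List.Relation.Unary.AllPairs using (AllPairs)
open import Data.Rational using (ℚ; 0ℚ; 1ℚ) renaming (_+_ to _+ℚ_; _≤_ to _≤ℚ_)
open import Relation.Binary.PropositionalEquality using (_≡_)
open import Relation.Nullary using (¬_)

Odd : ℕ → Set
Odd n = ∃ λ m → n ≡ suc (2 * m)

CycSucc : (k : ℕ) → Fin k → Fin k → Set
CycSucc k a b = (suc (toℕ a) ≡ toℕ b) ⊎ (suc (toℕ a) ≡ k × toℕ b ≡ 0)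

CycAdj : (k : ℕ) → Fin k → Fin k → Set
CycAdj k a b = CycSucc k a b ⊎ CycSucc k b a

V : ℕ → ℕ → Set
V k1 k2 = Fin k1 × Fin k2

Adj : (k1 k2 : ℕ) → V k1 k2 → V k1 k2 → Set
Adj k1 k2 (x1 , x2) (y1 , y2) =
  (CycAdj k1 x1 y1 × x2 ≡ y2) ⊎ (x1 ≡ y1 × CycAdj k2 x2 y2)

-- an edge of T_{k1,k2}, given by an (oriented) pair of adjacent vertices
Edge : ℕ → ℕ → Set
Edge k1 k2 = Σ (V k1 k2 × V k1 k2) λ p → Adj k1 k2 (proj₁ p) (proj₂ p)

IsEdge : ∀ {k1 k2} → Edge k1 k2 → V k1 k2 → V k1 k2 → Set
IsEdge ((a , b) , _) u v = (a ≡ u × b ≡ v) ⊎ (a ≡ v × b ≡ u)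

SameEdge : ∀ {k1 k2} → Edge k1 k2 → Edge k1 k2 → Set
SameEdge e ((u , v) , _) = IsEdge e u v

allV : (k1 k2 : ℕ) → List (V k1 k2)
allV k1 k2 = cartesianProduct (allFin k1) (allFin k2)

sumℚ : List ℚ → ℚ
sumℚ = foldr _+ℚ_ 0ℚ

Alive : ∀ k1 k2 → List (V k1 k2) → List (Edge k1 k2) → V k1 k2 → V k1 k2 → Set
Alive k1 k2 Dv De u v =
  Adj k1 k2 u v × u ∉ Dv × v ∉ Dv × ¬ Any (λ e → IsEdge e u v) De

-- g is a fractional perfect matching of T_{k1,k2} − Dv − De.
-- g is given as a symmetric function on vertex pairs, vanishing off the edges
-- of the remaining graph (i.e. a function on its edge set).
record IsFPM (k1 k2 : ℕ) (Dv : List (V k1 k2)) (De : List (Edge k1 k2))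
             (g : V k1 k2 → V k1 k2 → ℚ) : Set where
  field
    symm    : ∀ u v → g u v ≡ g v u
    lower   : ∀ u v → 0ℚ ≤ℚ g u v
    upper   : ∀ u v → g u v ≤ℚ 1ℚ
    support : ∀ u v → ¬ Alive k1 k2 Dv De u v → g u v ≡ 0ℚ
    perfect : ∀ v → v ∉ Dv → sumℚ (map (g v) (allV k1 k2)) ≡ 1ℚ

HasFPM : ∀ k1 k2 → List (V k1 k2) → List (Edge k1 k2) → Set
HasFPM k1 k2 Dv De = ∃ λ g → IsFPM k1 k2 Dv De g

-- a set of vertices and edges (lists without repetitions)
record DelSet (k1 k2 : ℕ) : Set where
  constructor delSet
  field
    verts     : List (V k1 k2)
    edges     : List (Edge k1 k2)
    vertsDist : AllPairs (λ a b → ¬ a ≡ b) verts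
    edgesDist : AllPairs (λ e f → ¬ SameEdge e f) edges

size : ∀ {k1 k2} → DelSet k1 k2 → ℕ
size F = length (DelSet.verts F) + length (DelSet.edges F)

Destroys : ∀ {k1 k2} → DelSet k1 k2 → Set
Destroys {k1} {k2} F = ¬ HasFPM k1 k2 (DelSet.verts F) (DelSet.edges F)

-- fsmp(T_{k1,k2}) = n : n is the minimum size of F ⊆ V ∪ E whose deletion
-- leaves no fractional perfect matching
FsmpIs : ℕ → ℕ → ℕ → Set
FsmpIs k1 k2 n =
  (∃ λ (F : DelSet k1 k2) → size F ≡ n × Destroys F)
  × (∀ (F : DelSet k1 k2) → size F < n → ¬ Destroys F)

-- fmp(T_{k1,k2}) = n : same, with F ⊆ E
FmpIs : ℕ → ℕ → ℕ → Set
FmpIs k1 k2 n =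
  (∃ λ (F : DelSet k1 k2) → DelSet.verts F ≡ [] × size F ≡ n × Destroys F)
  × (∀ (F : DelSet k1 k2) → DelSet.verts F ≡ [] → size F < n → ¬ Destroys F)

-- For k = 2m + 1 the torus T(k,4) is four odd cycles (its rows) joined by vertical
-- edges.  Fractional perfect matchings are assembled row by row: a row carries weight ½ on every
-- edge, or is cut into horizontally matched pairs and holes, a hole being a deleted vertex or a
-- vertex matched with the row above or below.  After a translation moves a deleted vertex to the
-- origin (or a deleted horizontal edge into the last column), a handful of such plans covers every
-- deletion of at most two vertices and edges and every deletion of at most three edges.  Deleting the four edges at a vertex isolates it.  After deleting the origin and
-- the edges from (0,1) and (0,3) to the right, a weighting y of the vertices by 0 and ±1 is
-- non-negative on the ends of every remaining edge but has negative total; a fractional perfect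
-- matching g would give 0 ≤ Σ (y u + y w) g(u,w) = 2 Σ y.

module Submission where

open import Defs
open import Algebra.Bundles using (Ring)
open import Data.Bool using (Bool; true; false; if_then_else_; T; _xor_)
open import Data.Empty using (⊥; ⊥-elim)
open import Data.Fin as Fin using (Fin; zero; suc; toℕ; fromℕ; inject₁; lower₁)
import Data.Fin.Properties as Finₚ
open import Data.Fin.Permutation using (permutation)
open import Data.List using (List; []; _∷_; _++_; map; length; tabulate; allFin; cartesianProduct)
import Data.List.Properties as Listₚ
open import Data.List.Membership.Propositional using (_∈_; _∉_)
open import Data.List.Membership.Propositional.Properties using (∈-map⁺; ∈-map⁻)
open import Data.List.Relation.Unary.All as All using (All; []; _∷_)
open import Data.List.Relation.Unary.AllPairs using (AllPairs; []; _∷_)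
open import Data.List.Relation.Unary.Any as Any using (Any; here; there)
open import Data.Maybe using (Maybe; just; nothing)
import Data.Maybe.Properties as Maybeₚ
open import Data.Nat as ℕ using (ℕ; zero; suc; _+_; _∸_; _≤_; _<_; _<ᵇ_; z≤n; s≤s; pred)
import Data.Nat.Properties as ℕₚ
open import Data.Nat.GeneralisedArithmetic using (iterate)
open import Data.Nat.Tactic.RingSolver using (solve-∀)
open import Data.Product using (∃; ∃₂; _×_; _,_; proj₁; proj₂)
import Data.Product.Properties as Productₚ
open import Data.Rational as ℚ using (ℚ; 0ℚ; 1ℚ; ½; -_) renaming (_+_ to _+ℚ_; _*_ to _*ℚ_; _≤_ to _≤ℚ_; _<_ to _<ℚ_)
import Data.Rational.Properties as ℚₚ
import Data.Sum
open import Data.Sum using (_⊎_; inj₁; inj₂)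
open import Data.Unit using (⊤; tt)
open import Function using (_∘_; id; case_of_)
open import Relation.Binary.Definitions using (DecidableEquality; tri<; tri≈; tri>)
open import Relation.Binary.PropositionalEquality
open import Relation.Nullary using (¬_; Dec; yes; no; does; contradiction)
open import Algebra.Properties.Semiring.Sum (Ring.semiring ℚₚ.+-*-ring) using (sum-syntax; sum-cong-≗; sum-replicate-zero; sum-permute; ∑-distrib-+; ∑-comm; *-distribˡ-sum)


private variable n : ℕ

sucᶜ : Fin (suc n) → Fin (suc n)
sucᶜ {n} i with n ℕ.≟ toℕ i
... | yes _ = zero
... | no n≢i = suc (lower₁ i n≢i)

predᶜ : Fin (suc n) → Fin (suc n)
predᶜ {n} zero = fromℕ n
predᶜ (suc i) = inject₁ i

sucᶜ-last : (i : Fin (suc n)) → toℕ i ≡ n → sucᶜ i ≡ zero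
sucᶜ-last {n} i i≡n with n ℕ.≟ toℕ i
... | yes _ = refl
... | no n≢i = contradiction (sym i≡n) n≢i

toℕ-sucᶜ : (i : Fin (suc n)) → toℕ i ≢ n → toℕ (sucᶜ i) ≡ suc (toℕ i)
toℕ-sucᶜ {n} i i≢n with n ℕ.≟ toℕ i
... | yes n≡i = contradiction (sym n≡i) i≢n
... | no n≢i = cong suc (Finₚ.toℕ-lower₁ i n≢i)

toℕ-predᶜ-zero : toℕ (predᶜ {n} zero) ≡ n
toℕ-predᶜ-zero {n} = Finₚ.toℕ-fromℕ n

toℕ-predᶜ-suc : (i : Fin n) → toℕ (predᶜ (suc i)) ≡ toℕ i
toℕ-predᶜ-suc = Finₚ.toℕ-inject₁

sucᶜ-inject₁ : (i : Fin n) → sucᶜ (inject₁ i) ≡ suc i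
sucᶜ-inject₁ {n} i with n ℕ.≟ toℕ (inject₁ i)
... | yes n≡i = contradiction n≡i (Finₚ.toℕ-inject₁-≢ i)
... | no n≢i = cong suc (Finₚ.lower₁-inject₁′ i n≢i)

predᶜ-sucᶜ : (i : Fin (suc n)) → predᶜ (sucᶜ i) ≡ i
predᶜ-sucᶜ {n} i with n ℕ.≟ toℕ i
... | yes n≡i = Finₚ.toℕ-injective (trans (Finₚ.toℕ-fromℕ n) n≡i)
... | no n≢i = Finₚ.inject₁-lower₁ i n≢i

sucᶜ-predᶜ : (i : Fin (suc n)) → sucᶜ (predᶜ i) ≡ i
sucᶜ-predᶜ {n} zero = sucᶜ-last (fromℕ n) (Finₚ.toℕ-fromℕ n)
sucᶜ-predᶜ (suc i) = sucᶜ-inject₁ i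

sucᶜ-injective : {i j : Fin (suc n)} → sucᶜ i ≡ sucᶜ j → i ≡ j
sucᶜ-injective {i = i} {j} e = trans (sym (predᶜ-sucᶜ i)) (trans (cong predᶜ e) (predᶜ-sucᶜ j))

CycSucc-sucᶜ : (i : Fin (suc n)) → CycSucc (suc n) i (sucᶜ i)
CycSucc-sucᶜ {n} i with toℕ i ℕ.≟ n
... | yes i≡n = inj₂ (cong suc i≡n , cong toℕ (sucᶜ-last i i≡n))
... | no i≢n = inj₁ (sym (toℕ-sucᶜ i i≢n))

CycSucc⇒≡sucᶜ : (i j : Fin (suc n)) → CycSucc (suc n) i j → j ≡ sucᶜ i
CycSucc⇒≡sucᶜ i j (inj₁ 1+i≡j) =
  Finₚ.toℕ-injective (trans (sym 1+i≡j) (sym (toℕ-sucᶜ i i≢n)))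
  where
  i≢n : toℕ i ≢ _
  i≢n i≡n = ℕₚ.<⇒≢ (Finₚ.toℕ<n j) (trans (sym 1+i≡j) (cong suc i≡n))
CycSucc⇒≡sucᶜ i j (inj₂ (1+i≡1+n , j≡0)) =
  trans (Finₚ.toℕ-injective {j = zero} j≡0) (sym (sucᶜ-last i (ℕₚ.suc-injective 1+i≡1+n)))

toℕ-sucᶜ-cases : (i : Fin (suc n)) → (toℕ (sucᶜ i) ≡ suc (toℕ i)) ⊎ (toℕ i ≡ n × sucᶜ i ≡ zero)
toℕ-sucᶜ-cases {n} i with toℕ i ℕ.≟ n
... | yes i≡n = inj₂ (i≡n , sucᶜ-last i i≡n)
... | no i≢n = inj₁ (toℕ-sucᶜ i i≢n)

sucᶜ≢id : 1 ≤ n → (i : Fin (suc n)) → sucᶜ i ≢ i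
sucᶜ≢id 1≤n i e with toℕ-sucᶜ-cases i
... | inj₁ step = ℕₚ.1+n≢n (trans (sym step) (cong toℕ e))
... | inj₂ (i≡n , wrap) = ℕₚ.<⇒≢ 1≤n (trans (sym (cong toℕ (trans (sym e) wrap))) i≡n)

sucᶜ²≢id : 2 ≤ n → (i : Fin (suc n)) → sucᶜ (sucᶜ i) ≢ i
sucᶜ²≢id {n} 2≤n i e with toℕ-sucᶜ-cases i | toℕ-sucᶜ-cases (sucᶜ i)
... | inj₁ step₁ | inj₁ step₂ =
  ℕₚ.<⇒≢ (ℕₚ.<-trans (ℕₚ.n<1+n _) (ℕₚ.n<1+n _)) (trans (sym (cong toℕ e)) (trans step₂ (cong suc step₁)))
... | inj₁ step₁ | inj₂ (si≡n , wrap₂) =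
  ℕₚ.<⇒≢ 2≤n (trans (cong suc (sym (cong toℕ (trans (sym e) wrap₂)))) (trans (sym step₁) si≡n))
... | inj₂ (i≡n , wrap₁) | inj₁ step₂ =
  ℕₚ.<⇒≢ 2≤n (trans (sym (trans step₂ (cong (suc ∘ toℕ) wrap₁))) (trans (cong toℕ e) i≡n))
... | inj₂ (_ , wrap₁) | inj₂ (si≡n , _) =
  ℕₚ.<⇒≢ (ℕₚ.<-trans (s≤s z≤n) 2≤n) (trans (sym (cong toℕ wrap₁)) si≡n)

shift : ℕ → Fin (suc n) → Fin (suc n)
shift j i = iterate sucᶜ i j

shift-sucᶜ : ∀ j (i : Fin (suc n)) → shift j (sucᶜ i) ≡ sucᶜ (shift j i)
shift-sucᶜ zero i = refl
shift-sucᶜ (suc j) i = shift-sucᶜ j (sucᶜ i)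

shift-injective : ∀ j {i i′ : Fin (suc n)} → shift j i ≡ shift j i′ → i ≡ i′
shift-injective zero e = e
shift-injective (suc j) e = sucᶜ-injective (shift-injective j e)

toℕ-shift : ∀ j (i : Fin (suc n)) → j + toℕ i ≤ n → toℕ (shift j i) ≡ j + toℕ i
toℕ-shift zero i _ = refl
toℕ-shift {n} (suc j) i j+1+i≤n = begin
  toℕ (shift j (sucᶜ i)) ≡⟨ toℕ-shift j (sucᶜ i) (subst (λ t → j + t ≤ n) (sym 1+i) j+i′≤n) ⟩
  j + toℕ (sucᶜ i)       ≡⟨ cong (j +_) 1+i ⟩
  j + suc (toℕ i)        ≡⟨ ℕₚ.+-suc j (toℕ i) ⟩
  suc j + toℕ i          ∎
  where
  open ≡-Reasoning
  j+i′≤n : j + suc (toℕ i) ≤ n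
  j+i′≤n = subst (_≤ n) (sym (ℕₚ.+-suc j (toℕ i))) j+1+i≤n
  1+i : toℕ (sucᶜ i) ≡ suc (toℕ i)
  1+i = toℕ-sucᶜ i (λ i≡n → ℕₚ.<⇒≱ (s≤s (ℕₚ.m≤n+m (toℕ i) j)) (subst (suc j + toℕ i ≤_) (sym i≡n) j+1+i≤n))

shift-to-zero : (i : Fin (suc n)) → ∃ λ j → shift j i ≡ zero
shift-to-zero {n} i = suc (n ∸ toℕ i) , (begin
  shift (n ∸ toℕ i) (sucᶜ i) ≡⟨ shift-sucᶜ (n ∸ toℕ i) i ⟩
  sucᶜ (shift (n ∸ toℕ i) i) ≡⟨ sucᶜ-last _ reaches-last ⟩
  zero                       ∎)
  where
  open ≡-Reasoning
  i≤n : toℕ i ≤ n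
  i≤n = ℕₚ.≤-pred (Finₚ.toℕ<n i)
  reaches-last : toℕ (shift (n ∸ toℕ i) i) ≡ n
  reaches-last = trans (toℕ-shift (n ∸ toℕ i) i (ℕₚ.≤-reflexive (ℕₚ.m∸n+n≡m i≤n))) (ℕₚ.m∸n+n≡m i≤n)

∑-zero : ∀ m (f : Fin m → ℚ) → (∀ i → f i ≡ 0ℚ) → ∑[ i < m ] f i ≡ 0ℚ
∑-zero m f f≡0 = trans (sum-cong-≗ f≡0) (sum-replicate-zero m)

∑-nonneg : ∀ m (f : Fin m → ℚ) → (∀ i → 0ℚ ≤ℚ f i) → 0ℚ ≤ℚ ∑[ i < m ] f i
∑-nonneg zero f _ = ℚₚ.≤-refl
∑-nonneg (suc m) f f≥0 = ℚₚ.+-mono-≤ (f≥0 zero) (∑-nonneg m (f ∘ suc) (f≥0 ∘ suc))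

≤-∑ : ∀ m (f : Fin m → ℚ) → (∀ i → 0ℚ ≤ℚ f i) → ∀ i → f i ≤ℚ ∑[ i < m ] f i
≤-∑ (suc m) f f≥0 zero = subst (_≤ℚ f zero +ℚ ∑[ i < m ] f (suc i)) (ℚₚ.+-identityʳ (f zero))
  (ℚₚ.+-monoʳ-≤ (f zero) (∑-nonneg m (f ∘ suc) (f≥0 ∘ suc)))
≤-∑ (suc m) f f≥0 (suc i) = ℚₚ.≤-trans (≤-∑ m (f ∘ suc) (f≥0 ∘ suc) i)
  (subst (_≤ℚ f zero +ℚ ∑[ i < m ] f (suc i)) (ℚₚ.+-identityˡ _) (ℚₚ.+-monoˡ-≤ (∑[ i < m ] f (suc i)) (f≥0 zero)))

∑-sucᶜ : (f : Fin (suc n) → ℚ) → ∑[ i < suc n ] f (sucᶜ i) ≡ ∑[ i < suc n ] f i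
∑-sucᶜ f = sym (sum-permute f (permutation sucᶜ predᶜ sucᶜ-predᶜ predᶜ-sucᶜ))

∑-shift : ∀ j (f : Fin (suc n) → ℚ) → ∑[ i < suc n ] f (shift j i) ≡ ∑[ i < suc n ] f i
∑-shift zero f = refl
∑-shift (suc j) f = trans (∑-sucᶜ (f ∘ shift j)) (∑-shift j f)

module _ {A : Set} (_≟_ : DecidableEquality A) where

  δ : A → A → ℚ → ℚ
  δ a b q = if does (a ≟ b) then q else 0ℚ

  δ-nonneg : ∀ a b {q} → 0ℚ ≤ℚ q → 0ℚ ≤ℚ δ a b q
  δ-nonneg a b 0≤q with a ≟ b
  ... | yes _ = 0≤q
  ... | no _ = ℚₚ.≤-refl

  δ-inverse : (f g : A → A) → (∀ x → g (f x) ≡ x) → (∀ y → f (g y) ≡ y) →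
              (h : A → ℚ) → ∀ v w → δ (f w) v (h w) ≡ δ (g v) w (h (g v))
  δ-inverse f g gf fg h v w with f w ≟ v | g v ≟ w
  ... | yes fw≡v | yes _ = cong h (trans (sym (gf w)) (cong g fw≡v))
  ... | yes fw≡v | no gv≢w = contradiction (trans (cong g (sym fw≡v)) (gf w)) gv≢w
  ... | no fw≢v | yes gv≡w = contradiction (trans (cong f (sym gv≡w)) (fg v)) fw≢v
  ... | no _ | no _ = refl

∑-δ : ∀ m (a : Fin m) q → ∑[ i < m ] δ Fin._≟_ a i q ≡ q
∑-δ (suc m) zero q = trans (cong (q +ℚ_) (∑-zero m _ (λ _ → refl))) (ℚₚ.+-identityʳ q)
∑-δ (suc m) (suc a) q = trans (ℚₚ.+-identityˡ _) (trans (sum-cong-≗ δ-suc) (∑-δ m a q))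
  where
  δ-suc : ∀ i → δ Fin._≟_ (suc a) (suc i) q ≡ δ Fin._≟_ a i q
  δ-suc i with a Fin.≟ i
  ... | yes _ = refl
  ... | no _ = refl

sumℚ-++ : ∀ xs ys → sumℚ (xs ++ ys) ≡ sumℚ xs +ℚ sumℚ ys
sumℚ-++ [] ys = sym (ℚₚ.+-identityˡ _)
sumℚ-++ (x ∷ xs) ys = trans (cong (x +ℚ_) (sumℚ-++ xs ys)) (sym (ℚₚ.+-assoc x _ _))

sumℚ-tabulate : ∀ m (f : Fin m → ℚ) → sumℚ (tabulate f) ≡ ∑[ i < m ] f i
sumℚ-tabulate zero f = refl
sumℚ-tabulate (suc m) f = cong (f zero +ℚ_) (sumℚ-tabulate m (f ∘ suc))

sumℚ-allFin : ∀ m (f : Fin m → ℚ) → sumℚ (map f (allFin m)) ≡ ∑[ i < m ] f i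
sumℚ-allFin m f = trans (cong sumℚ (Listₚ.map-tabulate id f)) (sumℚ-tabulate m f)

sumℚ-cartesianProduct : ∀ {A B : Set} (f : A × B → ℚ) xs ys →
  sumℚ (map f (cartesianProduct xs ys)) ≡ sumℚ (map (λ x → sumℚ (map (λ y → f (x , y)) ys)) xs)
sumℚ-cartesianProduct f [] ys = refl
sumℚ-cartesianProduct f (x ∷ xs) ys = begin
  sumℚ (map f (map (x ,_) ys ++ cartesianProduct xs ys))
    ≡⟨ cong sumℚ (Listₚ.map-++ f (map (x ,_) ys) _) ⟩
  sumℚ (map f (map (x ,_) ys) ++ map f (cartesianProduct xs ys))
    ≡⟨ sumℚ-++ (map f (map (x ,_) ys)) _ ⟩
  sumℚ (map f (map (x ,_) ys)) +ℚ sumℚ (map f (cartesianProduct xs ys))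
    ≡⟨ cong₂ _+ℚ_ (cong sumℚ (sym (Listₚ.map-∘ ys))) (sumℚ-cartesianProduct f xs ys) ⟩
  sumℚ (map (λ y → f (x , y)) ys) +ℚ sumℚ (map (λ x → sumℚ (map (λ y → f (x , y)) ys)) xs) ∎
  where open ≡-Reasoning

module _ {k₁ k₂ : ℕ} where

  ∑ᵥ : (V k₁ k₂ → ℚ) → ℚ
  ∑ᵥ f = ∑[ x < k₁ ] ∑[ y < k₂ ] f (x , y)

  sumℚ-allV : (f : V k₁ k₂ → ℚ) → sumℚ (map f (allV k₁ k₂)) ≡ ∑ᵥ f
  sumℚ-allV f = begin
    sumℚ (map f (allV k₁ k₂))
      ≡⟨ sumℚ-cartesianProduct f (allFin k₁) (allFin k₂) ⟩
    sumℚ (map (λ x → sumℚ (map (λ y → f (x , y)) (allFin k₂))) (allFin k₁))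
      ≡⟨ cong sumℚ (Listₚ.map-cong (λ x → sumℚ-allFin k₂ (λ y → f (x , y))) (allFin k₁)) ⟩
    sumℚ (map (λ x → ∑[ y < k₂ ] f (x , y)) (allFin k₁))
      ≡⟨ sumℚ-allFin k₁ _ ⟩
    ∑ᵥ f ∎
    where open ≡-Reasoning

  ∑ᵥ-cong : {f g : V k₁ k₂ → ℚ} → (∀ v → f v ≡ g v) → ∑ᵥ f ≡ ∑ᵥ g
  ∑ᵥ-cong f≡g = sum-cong-≗ (λ x → sum-cong-≗ (λ y → f≡g (x , y)))

  ∑ᵥ-distrib-+ : (f g : V k₁ k₂ → ℚ) → ∑ᵥ (λ v → f v +ℚ g v) ≡ ∑ᵥ f +ℚ ∑ᵥ g
  ∑ᵥ-distrib-+ f g = trans (sum-cong-≗ (λ x → ∑-distrib-+ (λ y → f (x , y)) (λ y → g (x , y))))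
                           (∑-distrib-+ (λ x → ∑[ y < k₂ ] f (x , y)) (λ x → ∑[ y < k₂ ] g (x , y)))

  ∑ᵥ-comm : (F : V k₁ k₂ → V k₁ k₂ → ℚ) → ∑ᵥ (λ u → ∑ᵥ (F u)) ≡ ∑ᵥ (λ w → ∑ᵥ (λ u → F u w))
  ∑ᵥ-comm F = begin
    ∑[ x < k₁ ] ∑[ y < k₂ ] ∑[ x′ < k₁ ] ∑[ y′ < k₂ ] F (x , y) (x′ , y′)
      ≡⟨ sum-cong-≗ (λ x → ∑-comm (λ y x′ → ∑[ y′ < k₂ ] F (x , y) (x′ , y′))) ⟩
    ∑[ x < k₁ ] ∑[ x′ < k₁ ] ∑[ y < k₂ ] ∑[ y′ < k₂ ] F (x , y) (x′ , y′)
      ≡⟨ ∑-comm (λ x x′ → ∑[ y < k₂ ] ∑[ y′ < k₂ ] F (x , y) (x′ , y′)) ⟩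
    ∑[ x′ < k₁ ] ∑[ x < k₁ ] ∑[ y < k₂ ] ∑[ y′ < k₂ ] F (x , y) (x′ , y′)
      ≡⟨ sum-cong-≗ (λ x′ → sum-cong-≗ (λ x → ∑-comm (λ y y′ → F (x , y) (x′ , y′)))) ⟩
    ∑[ x′ < k₁ ] ∑[ x < k₁ ] ∑[ y′ < k₂ ] ∑[ y < k₂ ] F (x , y) (x′ , y′)
      ≡⟨ sum-cong-≗ (λ x′ → ∑-comm (λ x y′ → ∑[ y < k₂ ] F (x , y) (x′ , y′))) ⟩
    ∑[ x′ < k₁ ] ∑[ y′ < k₂ ] ∑[ x < k₁ ] ∑[ y < k₂ ] F (x , y) (x′ , y′) ∎
    where open ≡-Reasoning

  ∑ᵥ-nonneg : (f : V k₁ k₂ → ℚ) → (∀ v → 0ℚ ≤ℚ f v) → 0ℚ ≤ℚ ∑ᵥ f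
  ∑ᵥ-nonneg f f≥0 = ∑-nonneg k₁ _ (λ x → ∑-nonneg k₂ _ (λ y → f≥0 (x , y)))

  ≤-∑ᵥ : (f : V k₁ k₂ → ℚ) → (∀ v → 0ℚ ≤ℚ f v) → ∀ v → f v ≤ℚ ∑ᵥ f
  ≤-∑ᵥ f f≥0 (x , y) = ℚₚ.≤-trans (≤-∑ k₂ _ (λ y → f≥0 (x , y)) y)
    (≤-∑ k₁ _ (λ x → ∑-nonneg k₂ _ (λ y → f≥0 (x , y))) x)

  ∑ᵥ-zero : (f : V k₁ k₂ → ℚ) → (∀ v → f v ≡ 0ℚ) → ∑ᵥ f ≡ 0ℚ
  ∑ᵥ-zero f f≡0 = ∑-zero k₁ _ (λ x → ∑-zero k₂ _ (λ y → f≡0 (x , y)))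

  *-distribˡ-∑ᵥ : ∀ c (f : V k₁ k₂ → ℚ) → c *ℚ ∑ᵥ f ≡ ∑ᵥ (λ v → c *ℚ f v)
  *-distribˡ-∑ᵥ c f = trans (*-distribˡ-sum c (λ x → ∑[ y < k₂ ] f (x , y)))
                            (sum-cong-≗ (λ x → *-distribˡ-sum c (λ y → f (x , y))))

  _≟ᵥ_ : DecidableEquality (V k₁ k₂)
  _≟ᵥ_ = Productₚ.≡-dec Fin._≟_ Fin._≟_

  δ-pair : ∀ a₁ a₂ x y q → δ _≟ᵥ_ (a₁ , a₂) (x , y) q ≡ δ Fin._≟_ a₁ x (δ Fin._≟_ a₂ y q)
  δ-pair a₁ a₂ x y q = decide ((a₁ , a₂) ≟ᵥ (x , y)) (a₁ Fin.≟ x) (a₂ Fin.≟ y)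
    where
    decide : (d : Dec ((a₁ , a₂) ≡ (x , y))) (d₁ : Dec (a₁ ≡ x)) (d₂ : Dec (a₂ ≡ y)) →
             (if does d then q else 0ℚ) ≡ (if does d₁ then (if does d₂ then q else 0ℚ) else 0ℚ)
    decide (yes _) (yes _) (yes _) = refl
    decide (yes e) (no a₁≢x) _ = contradiction (cong proj₁ e) a₁≢x
    decide (yes e) (yes _) (no a₂≢y) = contradiction (cong proj₂ e) a₂≢y
    decide (no ne) (yes refl) (yes refl) = contradiction refl ne
    decide (no _) (yes _) (no _) = refl
    decide (no _) (no _) _ = refl

  ∑ᵥ-δ : ∀ (a : V k₁ k₂) q → ∑ᵥ (λ w → δ _≟ᵥ_ a w q) ≡ q
  ∑ᵥ-δ (a₁ , a₂) q = trans (sum-cong-≗ column) (∑-δ k₁ a₁ q)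
    where
    column : ∀ x → ∑[ y < k₂ ] δ _≟ᵥ_ (a₁ , a₂) (x , y) q ≡ δ Fin._≟_ a₁ x q
    column x = trans (sum-cong-≗ (λ y → δ-pair a₁ a₂ x y q)) (by-cases (a₁ Fin.≟ x))
      where
      by-cases : (d : Dec (a₁ ≡ x)) →
        ∑[ y < k₂ ] (if does d then δ Fin._≟_ a₂ y q else 0ℚ) ≡ (if does d then q else 0ℚ)
      by-cases (yes _) = ∑-δ k₂ a₂ q
      by-cases (no _) = ∑-zero k₂ _ (λ _ → refl)

-- Fractional perfect matchings of a torus

Deleted : ∀ {k₁ k₂} → List (Edge k₁ k₂) → V k₁ k₂ → V k₁ k₂ → Set
Deleted De u w = Any (λ e → IsEdge e u w) De

module _ {k₁ k₂ : ℕ} where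

  Adj-sym : (u w : V k₁ k₂) → Adj k₁ k₂ u w → Adj k₁ k₂ w u
  Adj-sym u w (inj₁ (inj₁ s , e)) = inj₁ (inj₂ s , sym e)
  Adj-sym u w (inj₁ (inj₂ s , e)) = inj₁ (inj₁ s , sym e)
  Adj-sym u w (inj₂ (e , inj₁ s)) = inj₂ (sym e , inj₂ s)
  Adj-sym u w (inj₂ (e , inj₂ s)) = inj₂ (sym e , inj₁ s)

  Deleted-sym : ∀ {De : List (Edge k₁ k₂)} {u w} → Deleted De u w → Deleted De w u
  Deleted-sym = Any.map λ { (inj₁ p) → inj₂ p ; (inj₂ p) → inj₁ p }

  Alive-sym : ∀ {Dv De} (u w : V k₁ k₂) → Alive k₁ k₂ Dv De u w → Alive k₁ k₂ Dv De w u
  Alive-sym u w (uw , u∉ , w∉ , ¬del) = Adj-sym u w uw , w∉ , u∉ , ¬del ∘ Deleted-sym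

  Deleted⇒Adj : ∀ {De : List (Edge k₁ k₂)} {u w} → Deleted De u w → Adj k₁ k₂ u w
  Deleted⇒Adj (here {((a , b) , ab)} (inj₁ (refl , refl))) = ab
  Deleted⇒Adj (here {((a , b) , ab)} (inj₂ (refl , refl))) = Adj-sym a b ab
  Deleted⇒Adj (there d) = Deleted⇒Adj d


module _ {a b : ℕ} where

  private
    Vertex = V (suc a) (suc b)

  right left above below : Vertex → Vertex
  right (x , y) = (sucᶜ x , y)
  left (x , y) = (predᶜ x , y)
  above (x , y) = (x , sucᶜ y)
  below (x , y) = (x , predᶜ y)

  right-left : ∀ v → right (left v) ≡ v
  right-left (x , y) = cong (_, y) (sucᶜ-predᶜ x)

  left-right : ∀ v → left (right v) ≡ v
  left-right (x , y) = cong (_, y) (predᶜ-sucᶜ x)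

  above-below : ∀ v → above (below v) ≡ v
  above-below (x , y) = cong (x ,_) (sucᶜ-predᶜ y)

  below-above : ∀ v → below (above v) ≡ v
  below-above (x , y) = cong (x ,_) (predᶜ-sucᶜ y)

  Adj-right : ∀ u → Adj (suc a) (suc b) u (right u)
  Adj-right (x , y) = inj₁ (inj₁ (CycSucc-sucᶜ x) , refl)

  Adj-above : ∀ u → Adj (suc a) (suc b) u (above u)
  Adj-above (x , y) = inj₂ (refl , inj₁ (CycSucc-sucᶜ y))

  Adj⇒neighbours : ∀ u w → Adj (suc a) (suc b) u w →
    w ≡ right u ⊎ u ≡ right w ⊎ w ≡ above u ⊎ u ≡ above w
  Adj⇒neighbours (x , y) (x′ , y′) (inj₁ (inj₁ s , e)) = inj₁ (cong₂ _,_ (CycSucc⇒≡sucᶜ x x′ s) (sym e))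
  Adj⇒neighbours (x , y) (x′ , y′) (inj₁ (inj₂ s , e)) = inj₂ (inj₁ (cong₂ _,_ (CycSucc⇒≡sucᶜ x′ x s) e))
  Adj⇒neighbours (x , y) (x′ , y′) (inj₂ (e , inj₁ s)) = inj₂ (inj₂ (inj₁ (cong₂ _,_ (sym e) (CycSucc⇒≡sucᶜ y y′ s))))
  Adj⇒neighbours (x , y) (x′ , y′) (inj₂ (e , inj₂ s)) = inj₂ (inj₂ (inj₂ (cong₂ _,_ e (CycSucc⇒≡sucᶜ y′ y s))))

  record Weights (Dv : List Vertex) (De : List (Edge (suc a) (suc b))) : Set where
    field
      horizontal vertical : Vertex → ℚ
      horizontal-nonneg : ∀ u → 0ℚ ≤ℚ horizontal u
      vertical-nonneg : ∀ u → 0ℚ ≤ℚ vertical u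
      horizontal-alive : ∀ u → horizontal u ≡ 0ℚ ⊎ Alive (suc a) (suc b) Dv De u (right u)
      vertical-alive : ∀ u → vertical u ≡ 0ℚ ⊎ Alive (suc a) (suc b) Dv De u (above u)
      perfect : ∀ v → v ∉ Dv →
        (horizontal v +ℚ vertical v) +ℚ (horizontal (left v) +ℚ vertical (below v)) ≡ 1ℚ

  module _ {Dv De} (W : Weights Dv De) where

    open Weights W

    private
      δᵥ : Vertex → Vertex → ℚ → ℚ
      δᵥ = δ _≟ᵥ_

      ZeroOrAlive : Vertex → Vertex → ℚ → Set
      ZeroOrAlive u w q = q ≡ 0ℚ ⊎ Alive (suc a) (suc b) Dv De u w

    outgoing : Vertex → Vertex → ℚ
    outgoing u w = δᵥ (right u) w (horizontal u) +ℚ δᵥ (above u) w (vertical u)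

    weight : Vertex → Vertex → ℚ
    weight u w = outgoing u w +ℚ outgoing w u

    outgoing-nonneg : ∀ u w → 0ℚ ≤ℚ outgoing u w
    outgoing-nonneg u w = ℚₚ.+-mono-≤ (δ-nonneg _≟ᵥ_ (right u) w (horizontal-nonneg u))
                                      (δ-nonneg _≟ᵥ_ (above u) w (vertical-nonneg u))

    weight-nonneg : ∀ u w → 0ℚ ≤ℚ weight u w
    weight-nonneg u w = ℚₚ.+-mono-≤ (outgoing-nonneg u w) (outgoing-nonneg w u)

    outgoing-alive : ∀ u w → ZeroOrAlive u w (outgoing u w)
    outgoing-alive u w = +-alive (δ-alive (right u) (horizontal-alive u)) (δ-alive (above u) (vertical-alive u))
      where
      +-alive : ∀ {p q} → ZeroOrAlive u w p → ZeroOrAlive u w q → ZeroOrAlive u w (p +ℚ q)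
      +-alive (inj₁ refl) (inj₁ refl) = inj₁ refl
      +-alive (inj₁ _) (inj₂ alive) = inj₂ alive
      +-alive (inj₂ alive) _ = inj₂ alive
      δ-alive : ∀ t {q} → ZeroOrAlive u t q → ZeroOrAlive u w (δᵥ t w q)
      δ-alive t {q} z with t ≟ᵥ w
      ... | yes refl = z
      ... | no _ = inj₁ refl

    weight-support : ∀ u w → ¬ Alive (suc a) (suc b) Dv De u w → weight u w ≡ 0ℚ
    weight-support u w dead with outgoing-alive u w | outgoing-alive w u
    ... | inj₁ e | inj₁ e′ = trans (cong₂ _+ℚ_ e e′) (ℚₚ.+-identityˡ 0ℚ)
    ... | inj₂ alive | _ = contradiction alive dead
    ... | _ | inj₂ alive = contradiction (Alive-sym w u alive) dead

    ∑-weight : ∀ v → ∑ᵥ (weight v) ≡ (horizontal v +ℚ vertical v) +ℚ (horizontal (left v) +ℚ vertical (below v))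
    ∑-weight v = trans (∑ᵥ-distrib-+ (outgoing v) (λ w → outgoing w v)) (cong₂ _+ℚ_ ∑-outgoing ∑-incoming)
      where
      ∑-outgoing : ∑ᵥ (outgoing v) ≡ horizontal v +ℚ vertical v
      ∑-outgoing = trans (∑ᵥ-distrib-+ (λ w → δᵥ (right v) w (horizontal v)) (λ w → δᵥ (above v) w (vertical v)))
                         (cong₂ _+ℚ_ (∑ᵥ-δ (right v) _) (∑ᵥ-δ (above v) _))
      ∑-incoming : ∑ᵥ (λ w → outgoing w v) ≡ horizontal (left v) +ℚ vertical (below v)
      ∑-incoming = trans (∑ᵥ-distrib-+ (λ w → δᵥ (right w) v (horizontal w)) (λ w → δᵥ (above w) v (vertical w)))
        (cong₂ _+ℚ_ (trans (∑ᵥ-cong (δ-inverse _≟ᵥ_ right left left-right right-left horizontal v)) (∑ᵥ-δ (left v) _))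
                    (trans (∑ᵥ-cong (δ-inverse _≟ᵥ_ above below below-above above-below vertical v)) (∑ᵥ-δ (below v) _)))

    weight-perfect : ∀ v → v ∉ Dv → sumℚ (map (weight v) (allV (suc a) (suc b))) ≡ 1ℚ
    weight-perfect v v∉ = trans (sumℚ-allV (weight v)) (trans (∑-weight v) (perfect v v∉))

    weight-≤1 : ∀ u w → weight u w ≤ℚ 1ℚ
    weight-≤1 u w with Any.any? (u ≟ᵥ_) Dv
    ... | yes u∈ = subst (_≤ℚ 1ℚ) (sym (weight-support u w (λ alive → proj₁ (proj₂ alive) u∈))) (ℚₚ.nonNegative⁻¹ 1ℚ)
    ... | no u∉ = subst (weight u w ≤ℚ_) (trans (sym (sumℚ-allV (weight u))) (weight-perfect u u∉))
                        (≤-∑ᵥ (weight u) (weight-nonneg u) w)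

    Weights⇒HasFPM : HasFPM (suc a) (suc b) Dv De
    Weights⇒HasFPM = weight , record
      { symm = λ u w → ℚₚ.+-comm (outgoing u w) (outgoing w u)
      ; lower = weight-nonneg
      ; upper = weight-≤1
      ; support = weight-support
      ; perfect = weight-perfect }

module _ {k₁ k₂ : ℕ} {Dv : List (V k₁ k₂)} {De : List (Edge k₁ k₂)} where

  isolated⇒¬HasFPM : ∀ v → v ∉ Dv → (∀ w → ¬ Alive k₁ k₂ Dv De v w) → ¬ HasFPM k₁ k₂ Dv De
  isolated⇒¬HasFPM v v∉ isolated (g , fpm) = ℚₚ.<-irrefl 0≡1 (ℚₚ.positive⁻¹ 1ℚ)
    where
    open IsFPM fpm
    0≡1 : 0ℚ ≡ 1ℚ
    0≡1 = trans (sym (∑ᵥ-zero (g v) (λ w → support v w (isolated w))))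
                (trans (sym (sumℚ-allV (g v))) (perfect v v∉))

  module _ (y : V k₁ k₂ → ℚ) (y-deleted : ∀ v → v ∈ Dv → y v ≡ 0ℚ)
           (y-alive : ∀ u w → Alive k₁ k₂ Dv De u w → 0ℚ ≤ℚ y u +ℚ y w)
           {g : V k₁ k₂ → V k₁ k₂ → ℚ} (fpm : IsFPM k₁ k₂ Dv De g) where

    open IsFPM fpm
    open ≡-Reasoning

    ∑-scaled-row : ∀ u → ∑ᵥ (λ w → y u *ℚ g u w) ≡ y u
    ∑-scaled-row u with Any.any? (u ≟ᵥ_) Dv
    ... | yes u∈ = begin
      ∑ᵥ (λ w → y u *ℚ g u w) ≡⟨ ∑ᵥ-cong (λ w → cong (_*ℚ g u w) (y-deleted u u∈)) ⟩
      ∑ᵥ (λ w → 0ℚ *ℚ g u w)  ≡⟨ ∑ᵥ-zero _ (λ w → ℚₚ.*-zeroˡ (g u w)) ⟩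
      0ℚ                      ≡⟨ sym (y-deleted u u∈) ⟩
      y u                     ∎
    ... | no u∉ = begin
      ∑ᵥ (λ w → y u *ℚ g u w) ≡⟨ sym (*-distribˡ-∑ᵥ (y u) (g u)) ⟩
      y u *ℚ ∑ᵥ (g u)         ≡⟨ cong (y u *ℚ_) (trans (sym (sumℚ-allV (g u))) (perfect u u∉)) ⟩
      y u *ℚ 1ℚ               ≡⟨ ℚₚ.*-identityʳ (y u) ⟩
      y u                     ∎

    pair-nonneg : ∀ u w → 0ℚ ≤ℚ (y u +ℚ y w) *ℚ g u w
    pair-nonneg u w with 0ℚ ℚₚ.≤? y u +ℚ y w
    ... | yes 0≤yu+yw = subst (_≤ℚ (y u +ℚ y w) *ℚ g u w) (ℚₚ.*-zeroˡ (g u w))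
      (ℚₚ.*-monoʳ-≤-nonNeg (g u w) {{ℚ.nonNegative (lower u w)}} 0≤yu+yw)
    ... | no yu+yw<0 = ℚₚ.≤-reflexive (sym (trans (cong ((y u +ℚ y w) *ℚ_)
      (support u w (yu+yw<0 ∘ y-alive u w))) (ℚₚ.*-zeroʳ (y u +ℚ y w))))

    ∑-pairs : ∑ᵥ (λ u → ∑ᵥ (λ w → (y u +ℚ y w) *ℚ g u w)) ≡ ∑ᵥ y +ℚ ∑ᵥ y
    ∑-pairs = begin
      ∑ᵥ (λ u → ∑ᵥ (λ w → (y u +ℚ y w) *ℚ g u w))
        ≡⟨ ∑ᵥ-cong (λ u → trans (∑ᵥ-cong (λ w → ℚₚ.*-distribʳ-+ (g u w) (y u) (y w)))
                                (∑ᵥ-distrib-+ (λ w → y u *ℚ g u w) (λ w → y w *ℚ g u w))) ⟩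
      ∑ᵥ (λ u → ∑ᵥ (λ w → y u *ℚ g u w) +ℚ ∑ᵥ (λ w → y w *ℚ g u w))
        ≡⟨ ∑ᵥ-distrib-+ (λ u → ∑ᵥ (λ w → y u *ℚ g u w)) (λ u → ∑ᵥ (λ w → y w *ℚ g u w)) ⟩
      ∑ᵥ (λ u → ∑ᵥ (λ w → y u *ℚ g u w)) +ℚ ∑ᵥ (λ u → ∑ᵥ (λ w → y w *ℚ g u w))
        ≡⟨ cong (∑ᵥ (λ u → ∑ᵥ (λ w → y u *ℚ g u w)) +ℚ_) (∑ᵥ-comm (λ u w → y w *ℚ g u w)) ⟩
      ∑ᵥ (λ u → ∑ᵥ (λ w → y u *ℚ g u w)) +ℚ ∑ᵥ (λ w → ∑ᵥ (λ u → y w *ℚ g u w))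
        ≡⟨ cong (∑ᵥ (λ u → ∑ᵥ (λ w → y u *ℚ g u w)) +ℚ_) (∑ᵥ-cong (λ w → ∑ᵥ-cong (λ u → cong (y w *ℚ_) (symm u w)))) ⟩
      ∑ᵥ (λ u → ∑ᵥ (λ w → y u *ℚ g u w)) +ℚ ∑ᵥ (λ w → ∑ᵥ (λ u → y w *ℚ g w u))
        ≡⟨ cong₂ _+ℚ_ (∑ᵥ-cong ∑-scaled-row) (∑ᵥ-cong ∑-scaled-row) ⟩
      ∑ᵥ y +ℚ ∑ᵥ y ∎

  certificate⇒¬HasFPM : (y : V k₁ k₂ → ℚ) → (∀ v → v ∈ Dv → y v ≡ 0ℚ) →
    (∀ u w → Alive k₁ k₂ Dv De u w → 0ℚ ≤ℚ y u +ℚ y w) → ∑ᵥ y <ℚ 0ℚ → ¬ HasFPM k₁ k₂ Dv De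
  certificate⇒¬HasFPM y y-deleted y-alive ∑y<0 (g , fpm) =
    ℚₚ.<-irrefl refl (ℚₚ.≤-<-trans 0≤2∑y (ℚₚ.+-mono-< ∑y<0 ∑y<0))
    where
    0≤2∑y : 0ℚ ≤ℚ ∑ᵥ y +ℚ ∑ᵥ y
    0≤2∑y = subst (0ℚ ≤ℚ_) (∑-pairs y y-deleted y-alive fpm)
      (∑ᵥ-nonneg _ (λ u → ∑ᵥ-nonneg _ (pair-nonneg y y-deleted y-alive fpm u)))

module _ {a b : ℕ} where

  private
    Vertex = V (suc a) (suc b)

  rightEdge aboveEdge : Vertex → Edge (suc a) (suc b)
  rightEdge p = (p , right p) , Adj-right p
  aboveEdge p = (p , above p) , Adj-above p

  record _⊆ₑ_ (e e′ : Edge (suc a) (suc b)) : Set where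
    constructor endpoints
    field ⊆ₑ-endpoints : ∀ u w → IsEdge e u w → IsEdge e′ u w
  open _⊆ₑ_ public

  ⊆ₑ-refl : ∀ {p q : Vertex} {pq pq′} → ((p , q) , pq) ⊆ₑ ((p , q) , pq′)
  ⊆ₑ-refl = endpoints λ u w uw → uw

  ⊆ₑ-flip : ∀ {p q : Vertex} {pq pq′} → ((p , q) , pq) ⊆ₑ ((q , p) , pq′)
  ⊆ₑ-flip = endpoints λ { u w (inj₁ (p≡u , q≡w)) → inj₂ (q≡w , p≡u) ; u w (inj₂ (p≡w , q≡u)) → inj₁ (q≡u , p≡w) }

  Edge⇒right⊎above : (e : Edge (suc a) (suc b)) → (∃ λ p → e ⊆ₑ rightEdge p) ⊎ (∃ λ p → e ⊆ₑ aboveEdge p)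
  Edge⇒right⊎above (((x , y) , (x′ , y′)) , inj₁ (inj₁ s , refl)) with CycSucc⇒≡sucᶜ x x′ s
  ... | refl = inj₁ ((x , y) , ⊆ₑ-refl)
  Edge⇒right⊎above (((x , y) , (x′ , y′)) , inj₁ (inj₂ s , refl)) with CycSucc⇒≡sucᶜ x′ x s
  ... | refl = inj₁ ((x′ , y) , ⊆ₑ-flip)
  Edge⇒right⊎above (((x , y) , (x′ , y′)) , inj₂ (refl , inj₁ s)) with CycSucc⇒≡sucᶜ y y′ s
  ... | refl = inj₂ ((x , y) , ⊆ₑ-refl)
  Edge⇒right⊎above (((x , y) , (x′ , y′)) , inj₂ (refl , inj₂ s)) with CycSucc⇒≡sucᶜ y′ y s
  ... | refl = inj₂ ((x , y′) , ⊆ₑ-flip)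

  translate : ℕ → ℕ → Vertex → Vertex
  translate i j (x , y) = (shift i x , shift j y)

  module _ (i j : ℕ) where

    private
      τ = translate i j

    translate-injective : ∀ {u w} → τ u ≡ τ w → u ≡ w
    translate-injective e = cong₂ _,_ (shift-injective i (cong proj₁ e)) (shift-injective j (cong proj₂ e))

    translate-right : ∀ u → τ (right u) ≡ right (τ u)
    translate-right (x , y) = cong (_, shift j y) (shift-sucᶜ i x)

    translate-above : ∀ u → τ (above u) ≡ above (τ u)
    translate-above (x , y) = cong (shift i x ,_) (shift-sucᶜ j y)

    ∑ᵥ-translate : (f : Vertex → ℚ) → ∑ᵥ (f ∘ τ) ≡ ∑ᵥ f
    ∑ᵥ-translate f = trans (sum-cong-≗ (λ x → ∑-shift j (λ y → f (shift i x , y))))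
                           (∑-shift i (λ x → ∑[ y < suc b ] f (x , y)))

    Adj-translate⁻¹ : ∀ u w → Adj (suc a) (suc b) (τ u) (τ w) → Adj (suc a) (suc b) u w
    Adj-translate⁻¹ u w τuw with Adj⇒neighbours (τ u) (τ w) τuw
    ... | inj₁ e = subst (Adj _ _ u) (sym (translate-injective (trans e (sym (translate-right u))))) (Adj-right u)
    ... | inj₂ (inj₁ e) = subst (λ t → Adj _ _ t w) (sym (translate-injective (trans e (sym (translate-right w)))))
                            (Adj-sym w (right w) (Adj-right w))
    ... | inj₂ (inj₂ (inj₁ e)) = subst (Adj _ _ u) (sym (translate-injective (trans e (sym (translate-above u))))) (Adj-above u)
    ... | inj₂ (inj₂ (inj₂ e)) = subst (λ t → Adj _ _ t w) (sym (translate-injective (trans e (sym (translate-above w)))))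
                                   (Adj-sym w (above w) (Adj-above w))

    rightEdge-translate : ∀ p u w → IsEdge (rightEdge p) u w → IsEdge (rightEdge (τ p)) (τ u) (τ w)
    rightEdge-translate p u w (inj₁ (p≡u , rp≡w)) = inj₁ (cong τ p≡u , trans (sym (translate-right p)) (cong τ rp≡w))
    rightEdge-translate p u w (inj₂ (p≡w , rp≡u)) = inj₂ (cong τ p≡w , trans (sym (translate-right p)) (cong τ rp≡u))

    aboveEdge-translate : ∀ p u w → IsEdge (aboveEdge p) u w → IsEdge (aboveEdge (τ p)) (τ u) (τ w)
    aboveEdge-translate p u w (inj₁ (p≡u , ap≡w)) = inj₁ (cong τ p≡u , trans (sym (translate-above p)) (cong τ ap≡w))
    aboveEdge-translate p u w (inj₂ (p≡w , ap≡u)) = inj₂ (cong τ p≡w , trans (sym (translate-above p)) (cong τ ap≡u))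

    Deleted-translate : ∀ {De De′ : List (Edge (suc a) (suc b))} →
      (∀ u → Deleted De u (right u) → Deleted De′ (τ u) (right (τ u))) →
      (∀ u → Deleted De u (above u) → Deleted De′ (τ u) (above (τ u))) →
      ∀ u w → Deleted De u w → Deleted De′ (τ u) (τ w)
    Deleted-translate {De} {De′} right-ok above-ok u w del with Adj⇒neighbours u w (Deleted⇒Adj del)
    ... | inj₁ refl = subst (Deleted De′ (τ u)) (sym (translate-right u)) (right-ok u del)
    ... | inj₂ (inj₁ refl) = Deleted-sym (subst (Deleted De′ (τ w)) (sym (translate-right w)) (right-ok w (Deleted-sym del)))
    ... | inj₂ (inj₂ (inj₁ refl)) = subst (Deleted De′ (τ u)) (sym (translate-above u)) (above-ok u del)
    ... | inj₂ (inj₂ (inj₂ refl)) = Deleted-sym (subst (Deleted De′ (τ w)) (sym (translate-above w)) (above-ok w (Deleted-sym del)))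

    HasFPM-translate : ∀ {Dv De De′} → (∀ u w → Deleted De u w → Deleted De′ (τ u) (τ w)) →
      HasFPM (suc a) (suc b) (map τ Dv) De′ → HasFPM (suc a) (suc b) Dv De
    HasFPM-translate {Dv} {De} {De′} De↦De′ (g′ , fpm) = (λ u w → g′ (τ u) (τ w)) , record
      { symm = λ u w → symm (τ u) (τ w)
      ; lower = λ u w → lower (τ u) (τ w)
      ; upper = λ u w → upper (τ u) (τ w)
      ; support = λ u w dead → support (τ u) (τ w) (dead ∘ Alive-translate⁻¹ u w)
      ; perfect = λ v v∉ → begin
          sumℚ (map (λ w → g′ (τ v) (τ w)) (allV (suc a) (suc b))) ≡⟨ sumℚ-allV (g′ (τ v) ∘ τ) ⟩
          ∑ᵥ (g′ (τ v) ∘ τ)                                         ≡⟨ ∑ᵥ-translate (g′ (τ v)) ⟩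
          ∑ᵥ (g′ (τ v))                                             ≡⟨ sym (sumℚ-allV (g′ (τ v))) ⟩
          sumℚ (map (g′ (τ v)) (allV (suc a) (suc b)))              ≡⟨ perfect (τ v) (v∉ ∘ ∈-map-translate⁻¹) ⟩
          1ℚ                                                        ∎ }
      where
      open IsFPM fpm
      open ≡-Reasoning
      ∈-map-translate⁻¹ : ∀ {v} → τ v ∈ map τ Dv → v ∈ Dv
      ∈-map-translate⁻¹ τv∈ with ∈-map⁻ τ τv∈
      ... | v′ , v′∈ , τv≡τv′ = subst (_∈ Dv) (sym (translate-injective τv≡τv′)) v′∈
      Alive-translate⁻¹ : ∀ u w → Alive (suc a) (suc b) (map τ Dv) De′ (τ u) (τ w) → Alive (suc a) (suc b) Dv De u w
      Alive-translate⁻¹ u w (uw , u∉ , w∉ , ¬del) =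
        Adj-translate⁻¹ u w uw , u∉ ∘ ∈-map⁺ τ , w∉ ∘ ∈-map⁺ τ , ¬del ∘ De↦De′ u w

  translate-to-origin : ∀ p → ∃ λ i → ∃ λ j → translate i j p ≡ (zero , zero)
  translate-to-origin (x , y) with shift-to-zero x | shift-to-zero y
  ... | i , x↦0 | j , y↦0 = i , j , cong₂ _,_ x↦0 y↦0

  translate-to-last-column : ∀ p → ∃ λ i → proj₁ (translate i 0 p) ≡ predᶜ zero
  translate-to-last-column (x , y) with shift-to-zero (sucᶜ x)
  ... | i , sx↦0 = i , trans (sym (predᶜ-sucᶜ (shift i x))) (cong predᶜ (trans (sym (shift-sucᶜ i x)) sx↦0))

<ᵇ-true : ∀ {m n} → m < n → (m <ᵇ n) ≡ true
<ᵇ-true {m} {n} m<n with m <ᵇ n | ℕₚ.<⇒<ᵇ m<n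
... | true | _ = refl

<ᵇ-false : ∀ {m n} → n ≤ m → (m <ᵇ n) ≡ false
<ᵇ-false {m} {n} n≤m with m <ᵇ n in eq
... | false = refl
... | true = contradiction (ℕₚ.<ᵇ⇒< m n (subst T (sym eq) tt)) (ℕₚ.≤⇒≯ n≤m)

<ᵇ-true⁻¹ : ∀ {m n} → (m <ᵇ n) ≡ true → m < n
<ᵇ-true⁻¹ {m} {n} eq = ℕₚ.<ᵇ⇒< m n (subst T (sym eq) tt)

<ᵇ-false⁻¹ : ∀ {m n} → (m <ᵇ n) ≡ false → n ≤ m
<ᵇ-false⁻¹ {m} {n} eq = ℕₚ.≮⇒≥ (λ m<n → subst T eq (ℕₚ.<⇒<ᵇ m<n))

double-suc : ∀ a → suc a + suc a ≡ suc (suc (a + a))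
double-suc a = cong suc (ℕₚ.+-suc a a)

evenBit : ℕ → ℕ
evenBit zero = 1
evenBit (suc zero) = 0
evenBit (suc (suc y)) = evenBit y

evenBit-step : ∀ y → evenBit (suc y) + evenBit y ≡ 1
evenBit-step zero = refl
evenBit-step (suc zero) = refl
evenBit-step (suc (suc y)) = evenBit-step y

evenBit-even : ∀ j → evenBit (j + j) ≡ 1
evenBit-even zero = refl
evenBit-even (suc j) = trans (cong evenBit (double-suc j)) (evenBit-even j)

evenBit-odd : ∀ j → evenBit (suc (j + j)) ≡ 0
evenBit-odd zero = refl
evenBit-odd (suc j) = trans (cong (evenBit ∘ ℕ.suc) (double-suc j)) (evenBit-odd j)

odd≢even : ∀ a m → suc (a + a) ≢ m + m
odd≢even a m e with trans (sym (evenBit-odd a)) (trans (cong evenBit e) (evenBit-even m))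
... | ()

-- Rows built from segments

data Kind : Set where
  deleted up down : Kind

-- A row is read from column 0 as a sequence of segments: `pairs j` is 2j cells matched horizontally
-- in consecutive pairs, `holes κ m` is m cells not matched horizontally (deleted, or matched with the
-- cell above or below).  `kindAt ts y` is nothing on horizontally matched cells, and
-- `matchedAt ts y` is 1 exactly when cell y is matched with cell y + 1.
data Segment : Set where
  pairs : ℕ → Segment
  holes : Kind → ℕ → Segment

width : Segment → ℕ
width (pairs j) = j + j
width (holes _ m) = m

totalWidth : List Segment → ℕ
totalWidth [] = 0
totalWidth (t ∷ ts) = width t + totalWidth ts

segmentKind : Segment → Maybe Kind
segmentKind (pairs _) = nothing
segmentKind (holes κ _) = just κ

segmentMatched : Segment → ℕ → ℕ
segmentMatched (pairs _) y = evenBit y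
segmentMatched (holes _ _) y = 0

kindAt : List Segment → ℕ → Maybe Kind
kindAt [] y = nothing
kindAt (t ∷ ts) y = if y <ᵇ width t then segmentKind t else kindAt ts (y ∸ width t)

matchedAt : List Segment → ℕ → ℕ
matchedAt [] y = 0
matchedAt (t ∷ ts) y = if y <ᵇ width t then segmentMatched t y else matchedAt ts (y ∸ width t)

horizontalDegree : Maybe Kind → ℕ
horizontalDegree nothing = 1
horizontalDegree (just _) = 0

kindAt-inside : ∀ t ts y → y < width t → kindAt (t ∷ ts) y ≡ segmentKind t
kindAt-inside t ts y y<w rewrite <ᵇ-true y<w = refl

kindAt-beyond : ∀ t ts y → width t ≤ y → kindAt (t ∷ ts) y ≡ kindAt ts (y ∸ width t)
kindAt-beyond t ts y w≤y rewrite <ᵇ-false w≤y = refl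

matchedAt-inside : ∀ t ts y → y < width t → matchedAt (t ∷ ts) y ≡ segmentMatched t y
matchedAt-inside t ts y y<w rewrite <ᵇ-true y<w = refl

matchedAt-beyond : ∀ t ts y → width t ≤ y → matchedAt (t ∷ ts) y ≡ matchedAt ts (y ∸ width t)
matchedAt-beyond t ts y w≤y rewrite <ᵇ-false w≤y = refl

matchedAt-outside : ∀ ts y → totalWidth ts ≤ y → matchedAt ts y ≡ 0
matchedAt-outside [] y _ = refl
matchedAt-outside (t ∷ ts) y tot≤y =
  trans (matchedAt-beyond t ts y (ℕₚ.≤-trans (ℕₚ.m≤m+n (width t) (totalWidth ts)) tot≤y))
        (matchedAt-outside ts (y ∸ width t)
          (subst (_≤ y ∸ width t) (ℕₚ.m+n∸m≡n (width t) (totalWidth ts)) (ℕₚ.∸-monoˡ-≤ (width t) tot≤y)))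

matchedAt-first : ∀ ts → 0 < totalWidth ts → matchedAt ts 0 ≡ horizontalDegree (kindAt ts 0)
matchedAt-first (pairs zero ∷ ts) 0<tot = matchedAt-first ts 0<tot
matchedAt-first (pairs (suc j) ∷ ts) _ = refl
matchedAt-first (holes κ zero ∷ ts) 0<tot = matchedAt-first ts 0<tot
matchedAt-first (holes κ (suc m) ∷ ts) _ = refl

segmentMatched-last : ∀ t → 0 < width t → segmentMatched t (pred (width t)) ≡ 0
segmentMatched-last (pairs (suc j)) _ = trans (cong evenBit (ℕₚ.+-suc j j)) (evenBit-odd j)
segmentMatched-last (holes κ m) _ = refl

segmentMatched-step : ∀ t y → segmentMatched t (suc y) + segmentMatched t y ≡ horizontalDegree (segmentKind t)
segmentMatched-step (pairs j) y = evenBit-step y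
segmentMatched-step (holes κ m) y = refl

matchedAt-step : ∀ ts y → suc y < totalWidth ts →
  matchedAt ts (suc y) + matchedAt ts y ≡ horizontalDegree (kindAt ts (suc y))
matchedAt-step [] y ()
matchedAt-step (t ∷ ts) y 2+y≤tot with ℕₚ.<-cmp (suc y) (width t)
... | tri< 1+y<w _ _
  rewrite matchedAt-inside t ts (suc y) 1+y<w | matchedAt-inside t ts y (ℕₚ.<-trans (ℕₚ.n<1+n y) 1+y<w)
        | kindAt-inside t ts (suc y) 1+y<w = segmentMatched-step t y
... | tri≈ _ 1+y≡w _ = begin
  matchedAt (t ∷ ts) (suc y) + matchedAt (t ∷ ts) y
    ≡⟨ cong₂ _+_ (trans (matchedAt-beyond t ts (suc y) w≤1+y) (cong (matchedAt ts) 1+y∸w≡0))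
                 (trans (matchedAt-inside t ts y y<w) (trans (cong (segmentMatched t) (cong pred 1+y≡w))
                        (segmentMatched-last t (subst (0 <_) 1+y≡w (s≤s z≤n))))) ⟩
  matchedAt ts 0 + 0
    ≡⟨ trans (ℕₚ.+-identityʳ _) (matchedAt-first ts 0<tot) ⟩
  horizontalDegree (kindAt ts 0)
    ≡⟨ cong horizontalDegree (sym (trans (kindAt-beyond t ts (suc y) w≤1+y) (cong (kindAt ts) 1+y∸w≡0))) ⟩
  horizontalDegree (kindAt (t ∷ ts) (suc y)) ∎
  where
  open ≡-Reasoning
  w≤1+y : width t ≤ suc y
  w≤1+y = ℕₚ.≤-reflexive (sym 1+y≡w)
  y<w : y < width t
  y<w = subst (y <_) 1+y≡w (ℕₚ.n<1+n y)
  1+y∸w≡0 : suc y ∸ width t ≡ 0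
  1+y∸w≡0 = trans (cong (suc y ∸_) (sym 1+y≡w)) (ℕₚ.n∸n≡0 (suc y))
  0<tot : 0 < totalWidth ts
  0<tot = ℕₚ.+-cancelˡ-< (suc y) 0 (totalWidth ts)
    (subst₂ _<_ (sym (ℕₚ.+-identityʳ (suc y))) (cong (_+ totalWidth ts) (sym 1+y≡w)) 2+y≤tot)
... | tri> _ _ w<1+y
  rewrite matchedAt-beyond t ts (suc y) (ℕₚ.<⇒≤ w<1+y) | matchedAt-beyond t ts y (ℕₚ.≤-pred w<1+y)
        | kindAt-beyond t ts (suc y) (ℕₚ.<⇒≤ w<1+y) | ℕₚ.+-∸-assoc 1 (ℕₚ.≤-pred w<1+y) =
  matchedAt-step ts (y ∸ width t) (ℕₚ.+-cancelˡ-< (width t) _ _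
    (subst (_< width t + totalWidth ts)
      (sym (trans (ℕₚ.+-suc (width t) (y ∸ width t)) (cong suc (ℕₚ.m+[n∸m]≡n (ℕₚ.≤-pred w<1+y))))) 2+y≤tot))

matchedAt-last : ∀ ts y → suc y ≡ totalWidth ts → matchedAt ts y ≡ 0
matchedAt-last [] y ()
matchedAt-last (t ∷ ts) y 1+y≡tot with y <ᵇ width t in eq
... | true = trans (cong (segmentMatched t) (cong pred 1+y≡w)) (segmentMatched-last t (subst (0 <_) 1+y≡w (s≤s z≤n)))
  where
  y<w : y < width t
  y<w = <ᵇ-true⁻¹ eq
  tot≡0 : totalWidth ts ≡ 0
  tot≡0 = ℕₚ.n≤0⇒n≡0 (ℕₚ.+-cancelˡ-≤ (width t) _ _
    (subst (width t + totalWidth ts ≤_) (sym (ℕₚ.+-identityʳ (width t))) (subst (_≤ width t) 1+y≡tot y<w)))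
  1+y≡w : suc y ≡ width t
  1+y≡w = trans 1+y≡tot (trans (cong (width t +_) tot≡0) (ℕₚ.+-identityʳ (width t)))
... | false = matchedAt-last ts (y ∸ width t) (ℕₚ.+-cancelˡ-≡ (width t) _ _
  (trans (ℕₚ.+-suc (width t) (y ∸ width t)) (trans (cong suc (ℕₚ.m+[n∸m]≡n (<ᵇ-false⁻¹ {y} {width t} eq))) 1+y≡tot)))

-- A wrapped row matches column n with column 0 and lays its segments over the columns 1, …, n − 1.
wrappedKind : ℕ → List Segment → ℕ → Maybe Kind
wrappedKind n ts zero = nothing
wrappedKind n ts (suc y) = if suc y <ᵇ n then kindAt ts y else nothing

wrappedMatched : ℕ → List Segment → ℕ → ℕ
wrappedMatched n ts zero = 0
wrappedMatched n ts (suc y) = if suc y <ᵇ n then matchedAt ts y else 1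

wrappedKind-inside : ∀ n ts y → suc y < n → wrappedKind n ts (suc y) ≡ kindAt ts y
wrappedKind-inside n ts y 1+y<n rewrite <ᵇ-true 1+y<n = refl

wrappedKind⁻¹ : ∀ n ts y κ → wrappedKind n ts y ≡ just κ → ∃ λ y′ → y ≡ suc y′ × kindAt ts y′ ≡ just κ
wrappedKind⁻¹ n ts (suc y) κ e with suc y <ᵇ n
... | true = y , refl , e

HorizontallyMatched : (n : ℕ) → (ℕ → ℕ) → (ℕ → Maybe Kind) → Set
HorizontallyMatched n m κ = ∀ (x : Fin (suc n)) → m (toℕ x) + m (toℕ (predᶜ x)) ≡ horizontalDegree (κ (toℕ x))

linear-matched : ∀ n ts → totalWidth ts ≡ suc n → HorizontallyMatched n (matchedAt ts) (kindAt ts)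
linear-matched n ts fits zero rewrite toℕ-predᶜ-zero {n} | matchedAt-last ts n (sym fits) =
  trans (ℕₚ.+-identityʳ _) (matchedAt-first ts (subst (0 <_) (sym fits) (s≤s z≤n)))
linear-matched n ts fits (suc x) rewrite toℕ-predᶜ-suc x =
  matchedAt-step ts (toℕ x) (subst (suc (toℕ x) <_) (sym fits) (Finₚ.toℕ<n (suc x)))

wrapped-matched : ∀ n ts → suc (totalWidth ts) ≡ n → HorizontallyMatched n (wrappedMatched n ts) (wrappedKind n ts)
wrapped-matched .(suc (totalWidth ts)) ts refl zero
  rewrite Finₚ.toℕ-fromℕ (totalWidth ts) | <ᵇ-false {totalWidth ts} {totalWidth ts} ℕₚ.≤-refl = refl
wrapped-matched n ts fits (suc x) rewrite toℕ-predᶜ-suc x = step (toℕ x) (Finₚ.toℕ<n (suc x))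
  where
  step : ∀ y → suc y < suc n →
    wrappedMatched n ts (suc y) + wrappedMatched n ts y ≡ horizontalDegree (wrappedKind n ts (suc y))
  step y _ with suc y <ᵇ n in eq
  step zero _ | true = trans (ℕₚ.+-identityʳ _) (matchedAt-first ts (ℕₚ.≤-pred (subst (1 <_) (sym fits) (<ᵇ-true⁻¹ eq))))
  step (suc y) _ | true rewrite <ᵇ-true {suc y} {n} (ℕₚ.<-trans (ℕₚ.n<1+n (suc y)) (<ᵇ-true⁻¹ eq)) =
    matchedAt-step ts y (ℕₚ.≤-pred (subst (suc (suc y) <_) (sym fits) (<ᵇ-true⁻¹ eq)))
  step zero _ | false = refl
  step (suc y) 2+y≤1+n | false rewrite <ᵇ-true {suc y} {n} (ℕₚ.<-≤-trans (ℕₚ.n<1+n (suc y)) (ℕₚ.≤-pred 2+y≤1+n)) =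
    cong suc (matchedAt-last ts y (sym (ℕₚ.suc-injective (trans fits (ℕₚ.≤-antisym (<ᵇ-false⁻¹ eq) (ℕₚ.≤-pred 2+y≤1+n))))))

data Row : Set where
  halves : Row
  linear wrapped : List Segment → Row

Fits : ℕ → Row → Set
Fits n halves = ⊤
Fits n (linear ts) = totalWidth ts ≡ suc n
Fits n (wrapped ts) = suc (totalWidth ts) ≡ n

rowKind : ℕ → Row → ℕ → Maybe Kind
rowKind n halves y = nothing
rowKind n (linear ts) y = kindAt ts y
rowKind n (wrapped ts) y = wrappedKind n ts y

bit : ℕ → ℚ
bit zero = 0ℚ
bit (suc _) = 1ℚ

rowWeight : ℕ → Row → ℕ → ℚ
rowWeight n halves y = ½
rowWeight n (linear ts) y = bit (matchedAt ts y)
rowWeight n (wrapped ts) y = bit (wrappedMatched n ts y)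

upBit downBit : Maybe Kind → ℕ
upBit (just up) = 1
upBit _ = 0
downBit (just down) = 1
downBit _ = 0

bit-nonneg : ∀ a → 0ℚ ≤ℚ bit a
bit-nonneg zero = ℚₚ.≤-refl
bit-nonneg (suc _) = ℚₚ.nonNegative⁻¹ 1ℚ

horizontalDegree⇒nothing : ∀ a b k → a + b ≡ horizontalDegree k → 0 < a ⊎ 0 < b → k ≡ nothing
horizontalDegree⇒nothing a b nothing _ _ = refl
horizontalDegree⇒nothing (suc a) b (just _) () (inj₁ _)
horizontalDegree⇒nothing zero (suc b) (just _) () (inj₂ _)
horizontalDegree⇒nothing (suc a) (suc b) (just _) () (inj₂ _)

cell-total : ∀ a c k → a + c ≡ horizontalDegree k → k ≢ just deleted →
  (bit a +ℚ bit (upBit k)) +ℚ (bit c +ℚ bit (downBit k)) ≡ 1ℚ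
cell-total zero (suc zero) nothing _ _ = refl
cell-total (suc zero) zero nothing _ _ = refl
cell-total zero zero (just up) _ _ = refl
cell-total zero zero (just down) _ _ = refl
cell-total _ _ (just deleted) _ k≢del = contradiction refl k≢del
cell-total zero zero nothing () _
cell-total zero (suc (suc _)) nothing () _
cell-total (suc zero) (suc _) nothing () _
cell-total (suc (suc _)) _ nothing () _
cell-total (suc _) _ (just up) () _
cell-total zero (suc _) (just up) () _
cell-total (suc _) _ (just down) () _
cell-total zero (suc _) (just down) () _

upBit≡downBit : ∀ k′ k → (k′ ≡ just up → k ≡ just down) → (k ≡ just down → k′ ≡ just up) → upBit k′ ≡ downBit k
upBit≡downBit (just up) k up⇒down _ = cong downBit (sym (up⇒down refl))
upBit≡downBit k′ (just down) _ down⇒up = cong upBit (down⇒up refl)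
upBit≡downBit nothing nothing _ _ = refl
upBit≡downBit nothing (just deleted) _ _ = refl
upBit≡downBit nothing (just up) _ _ = refl
upBit≡downBit (just deleted) nothing _ _ = refl
upBit≡downBit (just deleted) (just deleted) _ _ = refl
upBit≡downBit (just deleted) (just up) _ _ = refl
upBit≡downBit (just down) nothing _ _ = refl
upBit≡downBit (just down) (just deleted) _ _ = refl
upBit≡downBit (just down) (just up) _ _ = refl

module _ {n : ℕ} where

  private
    matched⇒unholed : ∀ m κ → HorizontallyMatched n m κ → ∀ x → bit (m (toℕ x)) ≢ 0ℚ →
      κ (toℕ x) ≡ nothing × κ (toℕ (sucᶜ x)) ≡ nothing
    matched⇒unholed m κ step x w≢0 with m (toℕ x) in mx
    ... | zero = contradiction refl w≢0
    ... | suc _ = horizontalDegree⇒nothing (m (toℕ x)) _ _ (step x) (inj₁ (subst (0 <_) (sym mx) (s≤s z≤n))) ,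
      horizontalDegree⇒nothing (m (toℕ (sucᶜ x))) (m (toℕ x)) (κ (toℕ (sucᶜ x)))
        (subst (λ z → m (toℕ (sucᶜ x)) + m (toℕ z) ≡ horizontalDegree (κ (toℕ (sucᶜ x)))) (predᶜ-sucᶜ x) (step (sucᶜ x)))
        (inj₂ (subst (0 <_) (sym mx) (s≤s z≤n)))

    matched⇒total : ∀ m κ → HorizontallyMatched n m κ → ∀ x → κ (toℕ x) ≢ just deleted →
      (bit (m (toℕ x)) +ℚ bit (upBit (κ (toℕ x)))) +ℚ (bit (m (toℕ (predᶜ x))) +ℚ bit (downBit (κ (toℕ x)))) ≡ 1ℚ
    matched⇒total m κ step x = cell-total (m (toℕ x)) (m (toℕ (predᶜ x))) (κ (toℕ x)) (step x)

  rowWeight-nonneg : ∀ ρ y → 0ℚ ≤ℚ rowWeight n ρ y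
  rowWeight-nonneg halves y = ℚₚ.nonNegative⁻¹ ½
  rowWeight-nonneg (linear ts) y = bit-nonneg (matchedAt ts y)
  rowWeight-nonneg (wrapped ts) y = bit-nonneg (wrappedMatched n ts y)

  rowWeight-unholed : ∀ ρ → Fits n ρ → ∀ (x : Fin (suc n)) → rowWeight n ρ (toℕ x) ≢ 0ℚ →
    rowKind n ρ (toℕ x) ≡ nothing × rowKind n ρ (toℕ (sucᶜ x)) ≡ nothing
  rowWeight-unholed halves _ x _ = refl , refl
  rowWeight-unholed (linear ts) fits = matched⇒unholed (matchedAt ts) (kindAt ts) (linear-matched n ts fits)
  rowWeight-unholed (wrapped ts) fits = matched⇒unholed (wrappedMatched n ts) (wrappedKind n ts) (wrapped-matched n ts fits)

  rowWeight-total : ∀ ρ → Fits n ρ → ∀ (x : Fin (suc n)) → rowKind n ρ (toℕ x) ≢ just deleted →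
    (rowWeight n ρ (toℕ x) +ℚ bit (upBit (rowKind n ρ (toℕ x)))) +ℚ
    (rowWeight n ρ (toℕ (predᶜ x)) +ℚ bit (downBit (rowKind n ρ (toℕ x)))) ≡ 1ℚ
  rowWeight-total halves _ x _ = refl
  rowWeight-total (linear ts) fits = matched⇒total (matchedAt ts) (kindAt ts) (linear-matched n ts fits)
  rowWeight-total (wrapped ts) fits = matched⇒total (wrappedMatched n ts) (wrappedKind n ts) (wrapped-matched n ts fits)

Vertex : ℕ → Set
Vertex n = V (suc n) 4

module _ {n : ℕ} (rows : Fin 4 → Row) where

  kind : Vertex n → Maybe Kind
  kind (x , r) = rowKind n (rows r) (toℕ x)

  horizontalWeight verticalWeight : Vertex n → ℚ
  horizontalWeight (x , r) = rowWeight n (rows r) (toℕ x)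
  verticalWeight v = bit (upBit (kind v))

  record IsPlan (Dv : List (Vertex n)) (De : List (Edge (suc n) 4)) : Set where
    field
      fits : ∀ r → Fits n (rows r)
      up-down : ∀ u → kind u ≡ just up → kind (above u) ≡ just down
      down-up : ∀ u → kind (above u) ≡ just down → kind u ≡ just up
      deleted-sound : ∀ v → v ∈ Dv → kind v ≡ just deleted
      deleted-complete : ∀ v → kind v ≡ just deleted → v ∈ Dv
      right-deleted : ∀ u → Deleted De u (right u) → horizontalWeight u ≡ 0ℚ
      above-deleted : ∀ u → Deleted De u (above u) → kind u ≢ just up

  module _ {Dv De} (plan : IsPlan Dv De) where

    open IsPlan plan

    private
      not-deleted : ∀ {v κ} → kind v ≡ just κ → κ ≢ deleted → v ∉ Dv
      not-deleted kv κ≢del v∈ = κ≢del (Maybeₚ.just-injective (trans (sym kv) (deleted-sound _ v∈)))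

      unholed⇒∉ : ∀ {v} → kind v ≡ nothing → v ∉ Dv
      unholed⇒∉ kv v∈ = case trans (sym kv) (deleted-sound _ v∈) of λ ()

    horizontalWeight-alive : ∀ u → horizontalWeight u ≡ 0ℚ ⊎ Alive (suc n) 4 Dv De u (right u)
    horizontalWeight-alive (x , r) with horizontalWeight (x , r) ℚ.≟ 0ℚ
    ... | yes w≡0 = inj₁ w≡0
    ... | no w≢0 = inj₂ (Adj-right (x , r) , unholed⇒∉ kx , unholed⇒∉ kx′ , w≢0 ∘ right-deleted (x , r))
      where
      kx = proj₁ (rowWeight-unholed (rows r) (fits r) x w≢0)
      kx′ = proj₂ (rowWeight-unholed (rows r) (fits r) x w≢0)

    verticalWeight-alive : ∀ u → verticalWeight u ≡ 0ℚ ⊎ Alive (suc n) 4 Dv De u (above u)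
    verticalWeight-alive u with kind u in ku
    ... | nothing = inj₁ refl
    ... | just deleted = inj₁ refl
    ... | just down = inj₁ refl
    ... | just up = inj₂ (Adj-above u , not-deleted ku (λ ()) , not-deleted (up-down u ku) (λ ()) , λ del → above-deleted u del ku)

    upBit-below : ∀ v → upBit (kind (below v)) ≡ downBit (kind v)
    upBit-below v = upBit≡downBit (kind (below v)) (kind v)
      (λ kb → subst (λ w → kind w ≡ just down) (above-below v) (up-down (below v) kb))
      (λ kv → down-up (below v) (subst (λ w → kind w ≡ just down) (sym (above-below v)) kv))

    IsPlan⇒Weights : Weights Dv De
    IsPlan⇒Weights = record
      { horizontal = horizontalWeight
      ; vertical = verticalWeight
      ; horizontal-nonneg = λ { (x , r) → rowWeight-nonneg (rows r) (toℕ x) }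
      ; vertical-nonneg = λ v → bit-nonneg (upBit (kind v))
      ; horizontal-alive = horizontalWeight-alive
      ; vertical-alive = verticalWeight-alive
      ; perfect = λ { (x , r) v∉ → trans
          (cong (λ b → (horizontalWeight (x , r) +ℚ verticalWeight (x , r)) +ℚ (horizontalWeight (left (x , r)) +ℚ bit b))
                (upBit-below (x , r)))
          (rowWeight-total (rows r) (fits r) x (v∉ ∘ deleted-complete (x , r))) } }

placements : ℕ → List Segment → List (ℕ × Segment)
placements o [] = []
placements o (t ∷ ts) = (o , t) ∷ placements (o + width t) ts

private
  placement-offset : ∀ ts o₀ {o t} → (o , t) ∈ placements o₀ ts → o₀ ≤ o
  placement-offset (t ∷ ts) o₀ (here refl) = ℕₚ.≤-refl
  placement-offset (t ∷ ts) o₀ (there p) = ℕₚ.≤-trans (ℕₚ.m≤m+n o₀ (width t)) (placement-offset ts (o₀ + width t) p)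

  placement-cell : ∀ ts o₀ {o t} y → (o , t) ∈ placements o₀ ts → o ≤ y → y < o + width t →
    kindAt ts (y ∸ o₀) ≡ segmentKind t × matchedAt ts (y ∸ o₀) ≡ segmentMatched t (y ∸ o)
  placement-cell (t ∷ ts) o₀ y (here refl) o≤y y<o+w = kindAt-inside t ts (y ∸ o₀) inside , matchedAt-inside t ts (y ∸ o₀) inside
    where
    inside : y ∸ o₀ < width t
    inside = ℕₚ.+-cancelˡ-< o₀ _ _ (subst (_< o₀ + width t) (sym (ℕₚ.m+[n∸m]≡n o≤y)) y<o+w)
  placement-cell (t ∷ ts) o₀ {o} y (there p) o≤y y<o+w =
    trans (kindAt-beyond t ts (y ∸ o₀) w≤y∸o₀) (trans (cong (kindAt ts) shift-offset) (proj₁ rest)) ,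
    trans (matchedAt-beyond t ts (y ∸ o₀) w≤y∸o₀) (trans (cong (matchedAt ts) shift-offset) (proj₂ rest))
    where
    o₀+w≤y : o₀ + width t ≤ y
    o₀+w≤y = ℕₚ.≤-trans (placement-offset ts (o₀ + width t) p) o≤y
    w≤y∸o₀ : width t ≤ y ∸ o₀
    w≤y∸o₀ = ℕₚ.+-cancelˡ-≤ o₀ _ _
      (subst (o₀ + width t ≤_) (sym (ℕₚ.m+[n∸m]≡n (ℕₚ.≤-trans (ℕₚ.m≤m+n o₀ (width t)) o₀+w≤y))) o₀+w≤y)
    shift-offset : y ∸ o₀ ∸ width t ≡ y ∸ (o₀ + width t)
    shift-offset = ℕₚ.∸-+-assoc y o₀ (width t)
    rest = placement-cell ts (o₀ + width t) y p o≤y y<o+w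

  kindAt⁻¹-from : ∀ ts o₀ y κ → kindAt ts y ≡ just κ →
    ∃₂ λ o t → (o , t) ∈ placements o₀ ts × o ≤ y + o₀ × y + o₀ < o + width t × segmentKind t ≡ just κ
  kindAt⁻¹-from (t ∷ ts) o₀ y κ e with y <ᵇ width t in eq
  ... | true = o₀ , t , here refl , ℕₚ.m≤n+m o₀ y ,
    subst (_< o₀ + width t) (ℕₚ.+-comm o₀ y) (ℕₚ.+-monoʳ-< o₀ (<ᵇ-true⁻¹ eq)) , e
  ... | false with kindAt⁻¹-from ts (o₀ + width t) (y ∸ width t) κ e
  ... | o , t′ , p , o≤ , <w , kt = o , t′ , there p , subst (o ≤_) same o≤ , subst (_< o + width t′) same <w , kt
    where
    same : y ∸ width t + (o₀ + width t) ≡ y + o₀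
    same = trans (cong (y ∸ width t +_) (ℕₚ.+-comm o₀ (width t)))
      (trans (sym (ℕₚ.+-assoc (y ∸ width t) (width t) o₀)) (cong (_+ o₀) (ℕₚ.m∸n+n≡m (<ᵇ-false⁻¹ {y} {width t} eq))))

kindAt-placement : ∀ ts {o t} y → (o , t) ∈ placements 0 ts → o ≤ y → y < o + width t → kindAt ts y ≡ segmentKind t
kindAt-placement ts y p o≤y y<o+w = proj₁ (placement-cell ts 0 y p o≤y y<o+w)

matchedAt-placement : ∀ ts {o t} y → (o , t) ∈ placements 0 ts → o ≤ y → y < o + width t →
  matchedAt ts y ≡ segmentMatched t (y ∸ o)
matchedAt-placement ts y p o≤y y<o+w = proj₂ (placement-cell ts 0 y p o≤y y<o+w)

kindAt⁻¹ : ∀ ts y κ → kindAt ts y ≡ just κ →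
  ∃₂ λ o t → (o , t) ∈ placements 0 ts × o ≤ y × y < o + width t × segmentKind t ≡ just κ
kindAt⁻¹ ts y κ e with kindAt⁻¹-from ts 0 y κ e
... | o , t , p , o≤ , <w , kt = o , t , p , subst (o ≤_) (ℕₚ.+-identityʳ y) o≤ , subst (_< o + width t) (ℕₚ.+-identityʳ y) <w , kt

PlanHasFPM : ∀ {n} (rows : Fin 4 → Row) {Dv De} → IsPlan rows Dv De → HasFPM (suc n) 4 Dv De
PlanHasFPM rows plan = Weights⇒HasFPM (IsPlan⇒Weights rows plan)

module _ {n : ℕ} where

  rightEdge-right : 2 ≤ n → ∀ {p u : Vertex n} → IsEdge (rightEdge p) u (right u) → u ≡ p
  rightEdge-right _ (inj₁ (p≡u , _)) = sym p≡u
  rightEdge-right 2≤n {p} {u} (inj₂ (p≡ru , rp≡u)) =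
    ⊥-elim (sucᶜ²≢id 2≤n (proj₁ u) (cong proj₁ (trans (cong right (sym p≡ru)) rp≡u)))

  rightEdge-above : ∀ {p u : Vertex n} → ¬ IsEdge (rightEdge p) u (above u)
  rightEdge-above {p} {u} (inj₁ (p≡u , rp≡au)) =
    sucᶜ≢id (s≤s z≤n) (proj₂ u) (sym (cong proj₂ (trans (cong right (sym p≡u)) rp≡au)))
  rightEdge-above {p} {u} (inj₂ (p≡au , rp≡u)) =
    sucᶜ≢id (s≤s z≤n) (proj₂ u) (cong proj₂ (trans (cong right (sym p≡au)) rp≡u))

  aboveEdge-right : ∀ {p u : Vertex n} → ¬ IsEdge (aboveEdge p) u (right u)
  aboveEdge-right {p} {u} (inj₁ (p≡u , ap≡ru)) =
    sucᶜ≢id (s≤s z≤n) (proj₂ u) (cong proj₂ (trans (cong above (sym p≡u)) ap≡ru))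
  aboveEdge-right {p} {u} (inj₂ (p≡ru , ap≡u)) =
    sucᶜ≢id (s≤s z≤n) (proj₂ u) (cong proj₂ (trans (cong above (sym p≡ru)) ap≡u))

  aboveEdge-above : ∀ {p u : Vertex n} → IsEdge (aboveEdge p) u (above u) → u ≡ p
  aboveEdge-above (inj₁ (p≡u , _)) = sym p≡u
  aboveEdge-above {p} {u} (inj₂ (p≡au , ap≡u)) =
    ⊥-elim (sucᶜ²≢id (s≤s (s≤s z≤n)) (proj₂ u) (cong proj₂ (trans (cong above (sym p≡au)) ap≡u)))

oneHole : ℕ → Kind → ℕ → List Segment
oneHole a κ b = pairs a ∷ holes κ 1 ∷ pairs b ∷ []

module _ (a : ℕ) (κ : Kind) (b : ℕ) where

  private
    hole-inside : a + a < a + a + 1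
    hole-inside = subst (a + a <_) (ℕₚ.+-comm 1 (a + a)) (ℕₚ.n<1+n (a + a))

  totalWidth-oneHole : totalWidth (oneHole a κ b) ≡ suc (a + a + (b + b))
  totalWidth-oneHole = trans (ℕₚ.+-suc (a + a) (b + b + 0)) (cong (λ t → suc (a + a + t)) (ℕₚ.+-identityʳ (b + b)))

  kindAt-oneHole : kindAt (oneHole a κ b) (a + a) ≡ just κ
  kindAt-oneHole = kindAt-placement (oneHole a κ b) (a + a) (there (here refl)) ℕₚ.≤-refl hole-inside

  kindAt-oneHole⁻¹ : ∀ y κ′ → kindAt (oneHole a κ b) y ≡ just κ′ → y ≡ a + a × κ′ ≡ κ
  kindAt-oneHole⁻¹ y κ′ e with kindAt⁻¹ (oneHole a κ b) y κ′ e
  ... | _ , _ , here refl , _ , _ , ()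
  ... | _ , _ , there (here refl) , a+a≤y , y<a+a+1 , refl =
    ℕₚ.≤-antisym (ℕₚ.≤-pred (subst (y <_) (ℕₚ.+-comm (a + a) 1) y<a+a+1)) a+a≤y , refl
  ... | _ , _ , there (there (here refl)) , _ , _ , ()

  matchedAt-oneHole-hole : matchedAt (oneHole a κ b) (a + a) ≡ 0
  matchedAt-oneHole-hole = matchedAt-placement (oneHole a κ b) (a + a) (there (here refl)) ℕₚ.≤-refl hole-inside

  matchedAt-oneHole-before : ∀ y → y < a + a → matchedAt (oneHole a κ b) y ≡ evenBit y
  matchedAt-oneHole-before y y<a+a = matchedAt-placement (oneHole a κ b) y (here refl) z≤n y<a+a

  matchedAt-oneHole-after : ∀ y → a + a < y → y < suc (a + a + (b + b)) →
    matchedAt (oneHole a κ b) y ≡ evenBit (y ∸ suc (a + a))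
  matchedAt-oneHole-after y a+a<y y<tot =
    trans (matchedAt-placement (oneHole a κ b) y (there (there (here refl))) (subst (_≤ y) (ℕₚ.+-comm 1 (a + a)) a+a<y)
      (subst (y <_) (sym (trans (ℕₚ.+-assoc (a + a) 1 (b + b)) (ℕₚ.+-suc (a + a) (b + b)))) y<tot))
    (cong (λ o → evenBit (y ∸ o)) (ℕₚ.+-comm (a + a) 1))

hole-of : ∀ a κ b κ′ {y κ″} → kindAt (oneHole a κ b) y ≡ just κ″ → kindAt (oneHole a κ′ b) y ≡ just κ′
hole-of a κ b κ′ {y} {κ″} e = trans (cong (kindAt (oneHole a κ′ b)) (proj₁ (kindAt-oneHole⁻¹ a κ b y κ″ e))) (kindAt-oneHole a κ′ b)

matchedAt-hole-first : ∀ m κ a → matchedAt (oneHole 0 κ m) (a + a) ≡ 0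
matchedAt-hole-first m κ zero = matchedAt-oneHole-hole 0 κ m
matchedAt-hole-first m κ (suc a) with suc a + suc a ℕ.<? suc (m + m)
... | yes inside = trans (matchedAt-oneHole-after 0 κ m (suc a + suc a) (s≤s z≤n) inside)
                         (trans (cong evenBit (ℕₚ.+-suc a a)) (evenBit-odd a))
... | no outside = matchedAt-outside (oneHole 0 κ m) (suc a + suc a)
                     (subst (_≤ suc a + suc a) (sym (totalWidth-oneHole 0 κ m)) (ℕₚ.≮⇒≥ outside))

matchedAt-hole-last : ∀ m κ a → suc (a + a) ≤ m + m → matchedAt (oneHole m κ 0) (suc (a + a)) ≡ 0
matchedAt-hole-last m κ a odd≤ =
  trans (matchedAt-oneHole-before m κ 0 (suc (a + a)) (ℕₚ.≤∧≢⇒< odd≤ (odd≢even a m))) (evenBit-odd a)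

rowParity : Fin 4 → Bool
rowParity zero = false
rowParity (suc zero) = true
rowParity (suc (suc zero)) = false
rowParity (suc (suc (suc zero))) = true

verticalKind : Bool → Fin 4 → Kind
verticalKind σ r = if rowParity r xor σ then down else up

verticalKind-up-down : ∀ σ r → verticalKind σ r ≡ up → verticalKind σ (sucᶜ r) ≡ down
verticalKind-up-down false zero _ = refl
verticalKind-up-down false (suc (suc zero)) _ = refl
verticalKind-up-down true (suc zero) _ = refl
verticalKind-up-down true (suc (suc (suc zero))) _ = refl
verticalKind-up-down false (suc zero) ()
verticalKind-up-down false (suc (suc (suc zero))) ()
verticalKind-up-down true zero ()
verticalKind-up-down true (suc (suc zero)) ()

verticalKind-down-up : ∀ σ r → verticalKind σ (sucᶜ r) ≡ down → verticalKind σ r ≡ up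
verticalKind-down-up false zero _ = refl
verticalKind-down-up false (suc (suc zero)) _ = refl
verticalKind-down-up true (suc zero) _ = refl
verticalKind-down-up true (suc (suc (suc zero))) _ = refl
verticalKind-down-up false (suc zero) ()
verticalKind-down-up false (suc (suc (suc zero))) ()
verticalKind-down-up true zero ()
verticalKind-down-up true (suc (suc zero)) ()

verticalKind≢deleted : ∀ σ r → verticalKind σ r ≢ deleted
verticalKind≢deleted σ r with rowParity r xor σ
... | true = λ ()
... | false = λ ()

verticalKind-up⇒rowParity : ∀ σ r → verticalKind σ r ≡ up → rowParity r ≡ σ
verticalKind-up⇒rowParity false zero _ = refl
verticalKind-up⇒rowParity false (suc (suc zero)) _ = refl
verticalKind-up⇒rowParity true (suc zero) _ = refl
verticalKind-up⇒rowParity true (suc (suc (suc zero))) _ = refl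
verticalKind-up⇒rowParity false (suc zero) ()
verticalKind-up⇒rowParity false (suc (suc (suc zero))) ()
verticalKind-up⇒rowParity true zero ()
verticalKind-up⇒rowParity true (suc (suc zero)) ()

-- Fractional perfect matchings after deleting edges only

module _ {n : ℕ} where

  halves-HasFPM : ∀ {De} → (∀ u → ¬ Deleted De u (right u)) → HasFPM (suc n) 4 [] De
  halves-HasFPM no-right = PlanHasFPM (λ _ → halves) record
    { fits = λ _ → tt
    ; up-down = λ _ ()
    ; down-up = λ _ ()
    ; deleted-sound = λ _ ()
    ; deleted-complete = λ _ ()
    ; right-deleted = λ u del → contradiction del (no-right u)
    ; above-deleted = λ _ _ () }

  vertical-HasFPM : ∀ σ {De} → (∀ u → Deleted De u (above u) → verticalKind σ (proj₂ u) ≢ up) →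
    HasFPM (suc n) 4 [] De
  vertical-HasFPM σ {De} above-ok = PlanHasFPM rows record
    { fits = λ _ → ℕₚ.+-identityʳ (suc n)
    ; up-down = λ { (x , r) k≡up → trans (kind≡ x (sucᶜ r)) (cong just (verticalKind-up-down σ r (kind⁻¹ x r k≡up))) }
    ; down-up = λ { (x , r) k≡down → trans (kind≡ x r) (cong just (verticalKind-down-up σ r (kind⁻¹ x (sucᶜ r) k≡down))) }
    ; deleted-sound = λ _ ()
    ; deleted-complete = λ { (x , r) k≡del → contradiction (kind⁻¹ x r k≡del) (verticalKind≢deleted σ r) }
    ; right-deleted = λ { (x , r) _ → cong bit (matchedAt-allHoles {verticalKind σ r} (toℕ x)) }
    ; above-deleted = λ { (x , r) del k≡up → above-ok (x , r) del (kind⁻¹ x r k≡up) } }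
    where
    rows : Fin 4 → Row
    rows r = linear (holes (verticalKind σ r) (suc n) ∷ [])
    kind≡ : ∀ (x : Fin (suc n)) r → kind rows (x , r) ≡ just (verticalKind σ r)
    kind≡ x r = kindAt-inside (holes (verticalKind σ r) (suc n)) [] (toℕ x) (Finₚ.toℕ<n x)
    kind⁻¹ : ∀ x r {κ} → kind rows (x , r) ≡ just κ → verticalKind σ r ≡ κ
    kind⁻¹ x r e = Maybeₚ.just-injective (trans (sym (kind≡ x r)) e)
    matchedAt-allHoles : ∀ {κ} y → matchedAt (holes κ (suc n) ∷ []) y ≡ 0
    matchedAt-allHoles {κ} y with y ℕ.<ᵇ suc n
    ... | true = refl
    ... | false = refl

  oneHole-HasFPM : ∀ a b σ → a + a + (b + b) ≡ n → ∀ {De} →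
    (∀ u → Deleted De u (right u) → ∀ κ → matchedAt (oneHole a κ b) (toℕ (proj₁ u)) ≡ 0) →
    (∀ u → Deleted De u (above u) → verticalKind σ (proj₂ u) ≡ up → toℕ (proj₁ u) ≢ a + a) →
    HasFPM (suc n) 4 [] De
  oneHole-HasFPM a b σ a+b≡n {De} right-ok above-ok = PlanHasFPM rows record
    { fits = λ r → trans (totalWidth-oneHole a (verticalKind σ r) b) (cong suc a+b≡n)
    ; up-down = λ { (x , r) k≡up → let x≡ , κ≡ = kind⁻¹ x r up k≡up in
        trans (at-hole x (sucᶜ r) x≡) (cong just (verticalKind-up-down σ r (sym κ≡))) }
    ; down-up = λ { (x , r) k≡down → let x≡ , κ≡ = kind⁻¹ x (sucᶜ r) down k≡down in
        trans (at-hole x r x≡) (cong just (verticalKind-down-up σ r (sym κ≡))) }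
    ; deleted-sound = λ _ ()
    ; deleted-complete = λ { (x , r) k≡del → contradiction (sym (proj₂ (kind⁻¹ x r deleted k≡del))) (verticalKind≢deleted σ r) }
    ; right-deleted = λ { (x , r) del → cong bit (right-ok (x , r) del (verticalKind σ r)) }
    ; above-deleted = λ { (x , r) del k≡up → let x≡ , κ≡ = kind⁻¹ x r up k≡up in above-ok (x , r) del (sym κ≡) x≡ } }
    where
    rows : Fin 4 → Row
    rows r = linear (oneHole a (verticalKind σ r) b)
    kind⁻¹ : ∀ x r κ → kind rows (x , r) ≡ just κ → toℕ x ≡ a + a × κ ≡ verticalKind σ r
    kind⁻¹ x r κ = kindAt-oneHole⁻¹ a (verticalKind σ r) b (toℕ x) κ
    at-hole : ∀ x r → toℕ x ≡ a + a → kind rows (x , r) ≡ just (verticalKind σ r)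
    at-hole x r x≡ = trans (cong (kindAt (oneHole a (verticalKind σ r) b)) x≡) (kindAt-oneHole a (verticalKind σ r) b)

module _ {n : ℕ} where

  record Sorted (De : List (Edge (suc n) 4)) (hs vs₀ vs₁ : List (Vertex n)) : Set where
    field
      count : length hs + (length vs₀ + length vs₁) ≡ length De
      parity₀ : All (λ p → rowParity (proj₂ p) ≡ false) vs₀
      parity₁ : All (λ p → rowParity (proj₂ p) ≡ true) vs₁
      right-sorted : ∀ u → Deleted De u (right u) → u ∈ hs
      above-sorted : ∀ u → Deleted De u (above u) → u ∈ vs₀ ⊎ u ∈ vs₁

  sort : 2 ≤ n → ∀ De → ∃ λ hs → ∃ λ vs₀ → ∃ λ vs₁ → Sorted De hs vs₀ vs₁
  sort _ [] = [] , [] , [] , record { count = refl ; parity₀ = [] ; parity₁ = [] ; right-sorted = λ _ () ; above-sorted = λ _ () }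
  sort 2≤n (e ∷ De) with sort 2≤n De | Edge⇒right⊎above e
  ... | hs , vs₀ , vs₁ , s | inj₁ (p , e⊆) = p ∷ hs , vs₀ , vs₁ , record
    { count = cong suc count
    ; parity₀ = parity₀
    ; parity₁ = parity₁
    ; right-sorted = λ { u (here uv) → here (rightEdge-right 2≤n (⊆ₑ-endpoints e⊆ u (right u) uv))
                       ; u (there del) → there (right-sorted u del) }
    ; above-sorted = λ { u (here uv) → ⊥-elim (rightEdge-above (⊆ₑ-endpoints e⊆ u (above u) uv))
                       ; u (there del) → above-sorted u del } }
    where open Sorted s
  ... | hs , vs₀ , vs₁ , s | inj₂ (p , e⊆) with rowParity (proj₂ p) in parity
  ... | false = hs , p ∷ vs₀ , vs₁ , record
    { count = trans (ℕₚ.+-suc (length hs) _) (cong suc count)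
    ; parity₀ = parity ∷ parity₀
    ; parity₁ = parity₁
    ; right-sorted = λ { u (here uv) → ⊥-elim (aboveEdge-right (⊆ₑ-endpoints e⊆ u (right u) uv))
                       ; u (there del) → right-sorted u del }
    ; above-sorted = λ { u (here uv) → inj₁ (here (aboveEdge-above (⊆ₑ-endpoints e⊆ u (above u) uv)))
                       ; u (there del) → Data.Sum.map₁ there (above-sorted u del) } }
    where open Sorted s
  ... | true = hs , vs₀ , p ∷ vs₁ , record
    { count = trans (cong (length hs +_) (ℕₚ.+-suc (length vs₀) _)) (trans (ℕₚ.+-suc (length hs) _) (cong suc count))
    ; parity₀ = parity₀
    ; parity₁ = parity ∷ parity₁
    ; right-sorted = λ { u (here uv) → ⊥-elim (aboveEdge-right (⊆ₑ-endpoints e⊆ u (right u) uv))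
                       ; u (there del) → right-sorted u del }
    ; above-sorted = λ { u (here uv) → inj₂ (here (aboveEdge-above (⊆ₑ-endpoints e⊆ u (above u) uv)))
                       ; u (there del) → Data.Sum.map₂ there (above-sorted u del) } }
    where open Sorted s

module _ (m : ℕ) (1≤m : 1 ≤ m) where

  2≤m+m : 2 ≤ m + m
  2≤m+m = ℕₚ.+-mono-≤ 1≤m 1≤m

  -- With the deleted horizontal edge leaving the last column, rows with a single hole in the first
  -- or in the last column all leave it unused; one of three such plans also avoids both vertical edges.
  lastColumn-HasFPM : ∀ v₀ v₁ → rowParity (proj₂ v₀) ≡ false → rowParity (proj₂ v₁) ≡ true → ∀ {De} →
    (∀ u → Deleted De u (right u) → toℕ (proj₁ u) ≡ m + m) →
    (∀ u → Deleted De u (above u) → u ≡ v₀ ⊎ u ≡ v₁) →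
    HasFPM (suc (m + m)) 4 [] De
  lastColumn-HasFPM v₀ v₁ parity₀ parity₁ {De} last-column vertical-at =
    choose (toℕ (proj₁ v₀) ℕ.≟ 0) (toℕ (proj₁ v₁) ℕ.≟ 0)
    where
    avoid : ∀ σ a → (rowParity (proj₂ v₀) ≡ σ → toℕ (proj₁ v₀) ≢ a + a) →
                    (rowParity (proj₂ v₁) ≡ σ → toℕ (proj₁ v₁) ≢ a + a) →
            ∀ u → Deleted De u (above u) → verticalKind σ (proj₂ u) ≡ up → toℕ (proj₁ u) ≢ a + a
    avoid σ a ok₀ ok₁ u del k≡up with vertical-at u del
    ... | inj₁ refl = ok₀ (verticalKind-up⇒rowParity σ (proj₂ v₀) k≡up)
    ... | inj₂ refl = ok₁ (verticalKind-up⇒rowParity σ (proj₂ v₁) k≡up)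

    hole-first : ∀ u → Deleted De u (right u) → ∀ κ → matchedAt (oneHole 0 κ m) (toℕ (proj₁ u)) ≡ 0
    hole-first u del κ = trans (cong (matchedAt (oneHole 0 κ m)) (last-column u del)) (matchedAt-hole-first m κ m)

    hole-last : ∀ u → Deleted De u (right u) → ∀ κ → matchedAt (oneHole m κ 0) (toℕ (proj₁ u)) ≡ 0
    hole-last u del κ = trans (cong (matchedAt (oneHole m κ 0)) (last-column u del)) (matchedAt-oneHole-hole m κ 0)

    choose : Dec (toℕ (proj₁ v₀) ≡ 0) → Dec (toℕ (proj₁ v₁) ≡ 0) → HasFPM (suc (m + m)) 4 [] De
    choose (no v₀≢0) _ = oneHole-HasFPM 0 m false refl hole-first
      (avoid false 0 (λ _ → v₀≢0) (λ p → contradiction (trans (sym parity₁) p) λ ()))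
    choose (yes _) (no v₁≢0) = oneHole-HasFPM 0 m true refl hole-first
      (avoid true 0 (λ p → contradiction (trans (sym parity₀) p) λ ()) (λ _ → v₁≢0))
    choose (yes v₀≡0) (yes _) = oneHole-HasFPM m 0 false (ℕₚ.+-identityʳ (m + m)) hole-last
      (avoid false m (λ _ e → ℕₚ.<⇒≢ (ℕₚ.<-≤-trans (s≤s z≤n) 2≤m+m) (trans (sym v₀≡0) e))
                     (λ p → contradiction (trans (sym parity₁) p) λ ()))

  threeEdges-HasFPM : ∀ h v₀ v₁ → rowParity (proj₂ v₀) ≡ false → rowParity (proj₂ v₁) ≡ true → ∀ {De} →
    (∀ u → Deleted De u (right u) → u ≡ h) →
    (∀ u → Deleted De u (above u) → u ≡ v₀ ⊎ u ≡ v₁) →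
    HasFPM (suc (m + m)) 4 [] De
  threeEdges-HasFPM h v₀ v₁ parity₀ parity₁ {De} right-at above-at with translate-to-last-column h
  ... | i , h↦last = HasFPM-translate i 0 (Deleted-translate i 0 right-ok above-ok)
                       (lastColumn-HasFPM (τ v₀) (τ v₁) parity₀ parity₁ last-column vertical-at)
    where
    τ : Vertex (m + m) → Vertex (m + m)
    τ = translate i 0
    De′ : List (Edge (suc (m + m)) 4)
    De′ = rightEdge (τ h) ∷ aboveEdge (τ v₀) ∷ aboveEdge (τ v₁) ∷ []

    right-ok : ∀ u → Deleted De u (right u) → Deleted De′ (τ u) (right (τ u))
    right-ok u del with right-at u del
    ... | refl = here (inj₁ (refl , refl))
    above-ok : ∀ u → Deleted De u (above u) → Deleted De′ (τ u) (above (τ u))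
    above-ok u del with above-at u del
    ... | inj₁ refl = there (here (inj₁ (refl , refl)))
    ... | inj₂ refl = there (there (here (inj₁ (refl , refl))))

    last-column : ∀ u → Deleted De′ u (right u) → toℕ (proj₁ u) ≡ m + m
    last-column u (here uv) = trans (cong (toℕ ∘ proj₁) (rightEdge-right 2≤m+m uv))
                                    (trans (cong toℕ h↦last) toℕ-predᶜ-zero)
    last-column u (there (here uv)) = ⊥-elim (aboveEdge-right uv)
    last-column u (there (there (here uv))) = ⊥-elim (aboveEdge-right uv)

    vertical-at : ∀ u → Deleted De′ u (above u) → u ≡ τ v₀ ⊎ u ≡ τ v₁
    vertical-at u (here uv) = ⊥-elim (rightEdge-above uv)
    vertical-at u (there (here uv)) = inj₁ (aboveEdge-above uv)
    vertical-at u (there (there (here uv))) = inj₂ (aboveEdge-above uv)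

  private
    too-many : ∀ {k l} → 4 ≤ k → k ≡ l → l ≤ 3 → ⊥
    too-many 4≤k refl ≤3 = ℕₚ.<⇒≱ (s≤s ≤3) 4≤k

  -- Either no horizontal edge is deleted, or no vertical edge of one of the two vertical perfect
  -- matchings, or the (at most three) deleted edges are one of each kind.
  edges-HasFPM : ∀ De → length De ≤ 3 → HasFPM (suc (m + m)) 4 [] De
  edges-HasFPM De ≤3 with sort 2≤m+m De
  ... | [] , _ , _ , s = halves-HasFPM (λ u del → case Sorted.right-sorted s u del of λ ())
  ... | _ ∷ _ , _ , [] , s = vertical-HasFPM true λ u del k≡up → case Sorted.above-sorted s u del of λ
    { (inj₁ u∈) → contradiction (trans (sym (All.lookup (Sorted.parity₀ s) u∈)) (verticalKind-up⇒rowParity true (proj₂ u) k≡up)) λ () }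
  ... | _ ∷ _ , [] , _ ∷ _ , s = vertical-HasFPM false λ u del k≡up → case Sorted.above-sorted s u del of λ
    { (inj₂ u∈) → contradiction (trans (sym (All.lookup (Sorted.parity₁ s) u∈)) (verticalKind-up⇒rowParity false (proj₂ u) k≡up)) λ () }
  ... | h ∷ [] , v₀ ∷ [] , v₁ ∷ [] , s = threeEdges-HasFPM h v₀ v₁ (All.head parity₀) (All.head parity₁)
    (λ u del → case right-sorted u del of λ { (here u≡h) → u≡h })
    (λ u del → case above-sorted u del of λ { (inj₁ (here u≡v₀)) → inj₁ u≡v₀ ; (inj₂ (here u≡v₁)) → inj₂ u≡v₁ })
    where open Sorted s
  ... | _ ∷ _ ∷ _ , _ ∷ _ , _ ∷ _ , s =
    ⊥-elim (too-many (ℕₚ.+-mono-≤ {2} {_} {2} (s≤s (s≤s z≤n)) (ℕₚ.+-mono-≤ {1} {_} {1} (s≤s z≤n) (s≤s z≤n))) (Sorted.count s) ≤3)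
  ... | _ ∷ [] , _ ∷ _ ∷ _ , _ ∷ _ , s = ⊥-elim (too-many (s≤s (ℕₚ.+-mono-≤ {2} {_} {1} (s≤s (s≤s z≤n)) (s≤s z≤n))) (Sorted.count s) ≤3)
  ... | _ ∷ [] , _ ∷ [] , _ ∷ _ ∷ _ , s = ⊥-elim (too-many (s≤s (s≤s (s≤s (s≤s z≤n)))) (Sorted.count s) ≤3)

-- Plans deleting the origin

origin : ∀ {n} → Vertex n
origin = (zero , zero)

single-cell : ∀ {o y} → o ≤ y → y < o + 1 → y ≡ o
single-cell {o} {y} o≤y y<o+1 = ℕₚ.≤-antisym (ℕₚ.≤-pred (subst (y <_) (ℕₚ.+-comm o 1) y<o+1)) o≤y

module _ (m : ℕ) where

  deletedRow : Row
  deletedRow = linear (oneHole 0 deleted m)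

  deletedRow-kind : rowKind (m + m) deletedRow 0 ≡ just deleted
  deletedRow-kind = kindAt-oneHole 0 deleted m

  deletedRow-kind⁻¹ : ∀ (x : Fin (suc (m + m))) κ → rowKind (m + m) deletedRow (toℕ x) ≡ just κ → x ≡ zero × κ ≡ deleted
  deletedRow-kind⁻¹ x κ e with kindAt-oneHole⁻¹ 0 deleted m (toℕ x) κ e
  ... | x≡0 , κ≡ = Finₚ.toℕ-injective {j = zero} x≡0 , κ≡

  origin-HasFPM : ∀ {De} →
    (∀ u → Deleted De u (right u) → proj₂ u ≡ zero × matchedAt (oneHole 0 deleted m) (toℕ (proj₁ u)) ≡ 0) →
    HasFPM (suc (m + m)) 4 (origin ∷ []) De
  origin-HasFPM right-ok = PlanHasFPM {m + m} rows record
    { fits = λ { zero → totalWidth-oneHole 0 deleted m ; (suc _) → tt }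
    ; up-down = λ u k≡up → case proj₂ (kind⁻¹ u up k≡up) of λ ()
    ; down-up = λ u k≡down → case proj₂ (kind⁻¹ (above u) down k≡down) of λ ()
    ; deleted-sound = λ { _ (here refl) → deletedRow-kind ; _ (there ()) }
    ; deleted-complete = λ v k≡del → here (proj₁ (kind⁻¹ v deleted k≡del))
    ; right-deleted = λ { (x , zero) del → cong bit (proj₂ (right-ok (x , zero) del))
                        ; (x , suc r) del → case proj₁ (right-ok (x , suc r) del) of λ () }
    ; above-deleted = λ u _ k≡up → case proj₂ (kind⁻¹ u up k≡up) of λ () }
    where
    rows : Fin 4 → Row
    rows zero = deletedRow
    rows (suc _) = halves
    kind⁻¹ : ∀ (v : Vertex (m + m)) κ → kind rows v ≡ just κ → v ≡ origin × κ ≡ deleted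
    kind⁻¹ (x , zero) κ e with deletedRow-kind⁻¹ x κ e
    ... | refl , κ≡ = refl , κ≡

  wrappedHole-kind : ∀ a κ b → suc (suc (a + a + (b + b))) ≡ m + m →
    wrappedKind (m + m) (oneHole a κ b) (suc (a + a)) ≡ just κ
  wrappedHole-kind a κ b fits = trans (wrappedKind-inside (m + m) (oneHole a κ b) (a + a) inside) (kindAt-oneHole a κ b)
    where
    inside : suc (a + a) < m + m
    inside = subst (suc (a + a) <_) fits (s≤s (s≤s (ℕₚ.m≤m+n (a + a) (b + b))))

  wrappedHole-kind⁻¹ : ∀ a κ b y κ′ → wrappedKind (m + m) (oneHole a κ b) y ≡ just κ′ → y ≡ suc (a + a) × κ′ ≡ κ
  wrappedHole-kind⁻¹ a κ b y κ′ e with wrappedKind⁻¹ (m + m) (oneHole a κ b) y κ′ e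
  ... | y′ , refl , e′ with kindAt-oneHole⁻¹ a κ b y′ κ′ e′
  ... | y′≡ , κ′≡ = cong suc y′≡ , κ′≡

  -- The origin and the edge from column 2a+1 to 2a+2 in its row are deleted: those two cells are
  -- matched upwards and downwards instead.
  module OddEdgePlan (a b : ℕ) (fits : suc (suc (a + a + (b + b))) ≡ m + m) where

    private
      plus-one : ∀ {y} → y < suc y → y < y + 1
      plus-one {y} = subst (y <_) (ℕₚ.+-comm 1 y)
      row₀ : List Segment
      row₀ = holes deleted 1 ∷ pairs a ∷ holes up 1 ∷ holes down 1 ∷ pairs b ∷ []
      row₀-fits : totalWidth row₀ ≡ suc (m + m)
      row₀-fits = cong suc (trans (cong (a + a +_) (cong (λ k → ℕ.suc (ℕ.suc k)) (ℕₚ.+-identityʳ (b + b))))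
                    (trans (ℕₚ.+-suc (a + a) _) (trans (cong suc (ℕₚ.+-suc (a + a) (b + b))) fits)))
      rows : Fin 4 → Row
      rows zero = linear row₀
      rows (suc zero) = wrapped (oneHole a down b)
      rows (suc (suc zero)) = halves
      rows (suc (suc (suc zero))) = linear (oneHole (suc a) up b)
      row₀-kind⁻¹ : ∀ y κ → kindAt row₀ y ≡ just κ →
        (y ≡ 0 × κ ≡ deleted) ⊎ (y ≡ suc (a + a) × κ ≡ up) ⊎ (y ≡ suc (suc (a + a)) × κ ≡ down)
      row₀-kind⁻¹ y κ e with kindAt⁻¹ row₀ y κ e
      ... | _ , _ , here refl , o≤y , y<o+1 , refl = inj₁ (single-cell o≤y y<o+1 , refl)
      ... | _ , _ , there (there (here refl)) , o≤y , y<o+1 , refl = inj₂ (inj₁ (single-cell o≤y y<o+1 , refl))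
      ... | _ , _ , there (there (there (here refl))) , o≤y , y<o+1 , refl =
        inj₂ (inj₂ (trans (single-cell o≤y y<o+1) (ℕₚ.+-comm (suc (a + a)) 1) , refl))
      ... | _ , _ , there (here refl) , _ , _ , ()
      ... | _ , _ , there (there (there (there (here refl)))) , _ , _ , ()
      row₀-up : kindAt row₀ (suc (a + a)) ≡ just up
      row₀-up = kindAt-placement row₀ (suc (a + a)) (there (there (here refl))) ℕₚ.≤-refl (plus-one (ℕₚ.n<1+n _))
      row₀-down : kindAt row₀ (suc (suc (a + a))) ≡ just down
      row₀-down = kindAt-placement row₀ (suc (suc (a + a))) (there (there (there (here refl))))
        (ℕₚ.≤-reflexive (ℕₚ.+-comm (suc (a + a)) 1))
        (ℕₚ.≤-reflexive (trans (cong suc (sym (ℕₚ.+-comm (suc (a + a)) 1))) (ℕₚ.+-comm 1 (suc (a + a) + 1))))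
      row₃-up : kindAt (oneHole (suc a) up b) (suc (suc (a + a))) ≡ just up
      row₃-up = trans (cong (kindAt (oneHole (suc a) up b)) (sym (double-suc a))) (kindAt-oneHole (suc a) up b)
      up-down : ∀ u → kind rows u ≡ just up → kind rows (above u) ≡ just down
      up-down (x , zero) e with row₀-kind⁻¹ (toℕ x) up e
      ... | inj₂ (inj₁ (x≡ , _)) = trans (cong (wrappedKind (m + m) (oneHole a down b)) x≡) (wrappedHole-kind a down b fits)
      ... | inj₁ (_ , ())
      ... | inj₂ (inj₂ (_ , ()))
      up-down (x , suc zero) e = case proj₂ (wrappedHole-kind⁻¹ a down b (toℕ x) up e) of λ ()
      up-down (x , suc (suc (suc zero))) e = trans (cong (kindAt row₀) (trans (proj₁ (kindAt-oneHole⁻¹ (suc a) up b (toℕ x) up e)) (double-suc a))) row₀-down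
      down-up : ∀ u → kind rows (above u) ≡ just down → kind rows u ≡ just up
      down-up (x , zero) e = trans (cong (kindAt row₀) (proj₁ (wrappedHole-kind⁻¹ a down b (toℕ x) down e))) row₀-up
      down-up (x , suc (suc zero)) e = case proj₂ (kindAt-oneHole⁻¹ (suc a) up b (toℕ x) down e) of λ ()
      down-up (x , suc (suc (suc zero))) e with row₀-kind⁻¹ (toℕ x) down e
      ... | inj₂ (inj₂ (x≡ , _)) = trans (cong (kindAt (oneHole (suc a) up b)) x≡) row₃-up
      ... | inj₁ (_ , ())
      ... | inj₂ (inj₁ (_ , ()))
      deleted-complete : ∀ v → kind rows v ≡ just deleted → v ∈ origin ∷ []
      deleted-complete (x , zero) e with row₀-kind⁻¹ (toℕ x) deleted e
      ... | inj₁ (x≡0 , _) = here (cong (_, zero) (Finₚ.toℕ-injective {j = zero} x≡0))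
      ... | inj₂ (inj₁ (_ , ()))
      ... | inj₂ (inj₂ (_ , ()))
      deleted-complete (x , suc zero) e = case proj₂ (wrappedHole-kind⁻¹ a down b (toℕ x) deleted e) of λ ()
      deleted-complete (x , suc (suc (suc zero))) e = case proj₂ (kindAt-oneHole⁻¹ (suc a) up b (toℕ x) deleted e) of λ ()

    origin-oddEdge-HasFPM : ∀ {De} →
      (∀ u → Deleted De u (right u) → proj₂ u ≡ zero × toℕ (proj₁ u) ≡ suc (a + a)) →
      (∀ u → ¬ Deleted De u (above u)) →
      HasFPM (suc (m + m)) 4 (origin ∷ []) De
    origin-oddEdge-HasFPM right-ok no-above = PlanHasFPM {m + m} rows record
      { fits = λ { zero → row₀-fits ; (suc zero) → trans (cong suc (totalWidth-oneHole a down b)) fits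
                 ; (suc (suc zero)) → tt
                 ; (suc (suc (suc zero))) → trans (totalWidth-oneHole (suc a) up b) (cong suc (trans (cong (_+ (b + b)) (double-suc a)) fits)) }
      ; up-down = up-down
      ; down-up = down-up
      ; deleted-sound = λ { _ (here refl) → refl ; _ (there ()) }
      ; deleted-complete = deleted-complete
      ; right-deleted = λ { (x , r) del → case right-ok (x , r) del of λ { (refl , x≡) →
          cong bit (trans (cong (matchedAt row₀) x≡)
            (matchedAt-placement row₀ (suc (a + a)) (there (there (here refl))) ℕₚ.≤-refl (plus-one (ℕₚ.n<1+n _)))) } }
      ; above-deleted = λ u del _ → no-above u del }

  open OddEdgePlan public using (origin-oddEdge-HasFPM)

  -- The origin and a horizontal edge in another row are deleted: that row and a neighbouring one get
  -- a single hole each, matched with each other vertically.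
  origin-pair₁₂-HasFPM : ∀ a b → a + a + (b + b) ≡ m + m → ∀ {De} →
    (∀ u → Deleted De u (right u) →
       (proj₂ u ≡ suc zero ⊎ proj₂ u ≡ suc (suc zero)) × (∀ κ → matchedAt (oneHole a κ b) (toℕ (proj₁ u)) ≡ 0)) →
    (∀ u → ¬ Deleted De u (above u)) →
    HasFPM (suc (m + m)) 4 (origin ∷ []) De
  origin-pair₁₂-HasFPM a b fits right-ok no-above = PlanHasFPM {m + m} rows record
    { fits = λ { zero → totalWidth-oneHole 0 deleted m
               ; (suc zero) → trans (totalWidth-oneHole a up b) (cong suc fits)
               ; (suc (suc zero)) → trans (totalWidth-oneHole a down b) (cong suc fits)
               ; (suc (suc (suc zero))) → tt }
    ; up-down = λ { (x , zero) e → case proj₂ (deletedRow-kind⁻¹ x up e) of λ ()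
                  ; (x , suc zero) e → hole-of a up b down e
                  ; (x , suc (suc zero)) e → case proj₂ (kindAt-oneHole⁻¹ a down b (toℕ x) up e) of λ ()
                  ; (x , suc (suc (suc zero))) () }
    ; down-up = λ { (x , zero) e → case proj₂ (kindAt-oneHole⁻¹ a up b (toℕ x) down e) of λ ()
                  ; (x , suc zero) e → hole-of a down b up e
                  ; (x , suc (suc zero)) ()
                  ; (x , suc (suc (suc zero))) e → case proj₂ (deletedRow-kind⁻¹ x down e) of λ () }
    ; deleted-sound = λ { _ (here refl) → deletedRow-kind ; _ (there ()) }
    ; deleted-complete = λ
        { (x , zero) e → here (cong (_, zero) (proj₁ (deletedRow-kind⁻¹ x deleted e)))
        ; (x , suc zero) e → case proj₂ (kindAt-oneHole⁻¹ a up b (toℕ x) deleted e) of λ ()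
        ; (x , suc (suc zero)) e → case proj₂ (kindAt-oneHole⁻¹ a down b (toℕ x) deleted e) of λ ()
        ; (x , suc (suc (suc zero))) () }
    ; right-deleted = λ { (x , r) del → case right-ok (x , r) del of λ
        { (inj₁ refl , unused) → cong bit (unused up) ; (inj₂ refl , unused) → cong bit (unused down) } }
    ; above-deleted = λ u del _ → no-above u del }
    where
    rows : Fin 4 → Row
    rows zero = deletedRow
    rows (suc zero) = linear (oneHole a up b)
    rows (suc (suc zero)) = linear (oneHole a down b)
    rows (suc (suc (suc zero))) = halves

  origin-pair₂₃-HasFPM : ∀ a b → a + a + (b + b) ≡ m + m → ∀ {De} →
    (∀ u → Deleted De u (right u) →
       (proj₂ u ≡ suc (suc zero) ⊎ proj₂ u ≡ suc (suc (suc zero))) × (∀ κ → matchedAt (oneHole a κ b) (toℕ (proj₁ u)) ≡ 0)) →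
    (∀ u → ¬ Deleted De u (above u)) →
    HasFPM (suc (m + m)) 4 (origin ∷ []) De
  origin-pair₂₃-HasFPM a b fits right-ok no-above = PlanHasFPM {m + m} rows record
    { fits = λ { zero → totalWidth-oneHole 0 deleted m
               ; (suc zero) → tt
               ; (suc (suc zero)) → trans (totalWidth-oneHole a up b) (cong suc fits)
               ; (suc (suc (suc zero))) → trans (totalWidth-oneHole a down b) (cong suc fits) }
    ; up-down = λ { (x , zero) e → case proj₂ (deletedRow-kind⁻¹ x up e) of λ ()
                  ; (x , suc zero) ()
                  ; (x , suc (suc zero)) e → hole-of a up b down e
                  ; (x , suc (suc (suc zero))) e → case proj₂ (kindAt-oneHole⁻¹ a down b (toℕ x) up e) of λ () }
    ; down-up = λ { (x , zero) ()
                  ; (x , suc zero) e → case proj₂ (kindAt-oneHole⁻¹ a up b (toℕ x) down e) of λ ()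
                  ; (x , suc (suc zero)) e → hole-of a down b up e
                  ; (x , suc (suc (suc zero))) e → case proj₂ (deletedRow-kind⁻¹ x down e) of λ () }
    ; deleted-sound = λ { _ (here refl) → deletedRow-kind ; _ (there ()) }
    ; deleted-complete = λ
        { (x , zero) e → here (cong (_, zero) (proj₁ (deletedRow-kind⁻¹ x deleted e)))
        ; (x , suc zero) ()
        ; (x , suc (suc zero)) e → case proj₂ (kindAt-oneHole⁻¹ a up b (toℕ x) deleted e) of λ ()
        ; (x , suc (suc (suc zero))) e → case proj₂ (kindAt-oneHole⁻¹ a down b (toℕ x) deleted e) of λ () }
    ; right-deleted = λ { (x , r) del → case right-ok (x , r) del of λ
        { (inj₁ refl , unused) → cong bit (unused up) ; (inj₂ refl , unused) → cong bit (unused down) } }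
    ; above-deleted = λ u del _ → no-above u del }
    where
    rows : Fin 4 → Row
    rows zero = deletedRow
    rows (suc zero) = halves
    rows (suc (suc zero)) = linear (oneHole a up b)
    rows (suc (suc (suc zero))) = linear (oneHole a down b)

parity : ∀ y → ∃ λ a → y ≡ a + a ⊎ y ≡ suc (a + a)
parity zero = 0 , inj₁ refl
parity (suc zero) = 0 , inj₂ refl
parity (suc (suc y)) with parity y
... | a , inj₁ y≡ = suc a , inj₁ (trans (cong (ℕ.suc ∘ ℕ.suc) y≡) (cong ℕ.suc (sym (ℕₚ.+-suc a a))))
... | a , inj₂ y≡ = suc a , inj₂ (trans (cong (ℕ.suc ∘ ℕ.suc) y≡) (cong (ℕ.suc ∘ ℕ.suc) (sym (ℕₚ.+-suc a a))))

half-≤ : ∀ {a m} → a + a ≤ m + m → a ≤ m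
half-≤ {a} {m} 2a≤2m = ℕₚ.≮⇒≥ (λ m<a → ℕₚ.<⇒≱ (ℕₚ.+-mono-< m<a m<a) 2a≤2m)

split-even : ∀ m a → a + a ≤ m + m → ∃ λ b → a + a + (b + b) ≡ m + m
split-even m a 2a≤2m = m ∸ a , trans (regroup a (m ∸ a)) (cong (λ k → k + k) (ℕₚ.m+[n∸m]≡n (half-≤ {a} {m} 2a≤2m)))
  where
  regroup : ∀ a d → a + a + (d + d) ≡ (a + d) + (a + d)
  regroup = solve-∀

split-odd : ∀ m a → suc (a + a) ≤ m + m → ∃ λ b → suc (suc (a + a + (b + b))) ≡ m + m
split-odd m a 2a+1≤2m = m ∸ suc a , trans (regroup a (m ∸ suc a)) (cong (λ k → k + k) (ℕₚ.m+[n∸m]≡n a<m))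
  where
  regroup : ∀ a d → suc (suc (a + a + (d + d))) ≡ (suc a + d) + (suc a + d)
  regroup = solve-∀
  a<m : suc a ≤ m
  a<m = ℕₚ.≮⇒≥ (λ m<1+a → let m≤a = ℕₚ.≤-pred m<1+a in
    ℕₚ.<-irrefl refl (ℕₚ.<-≤-trans (s≤s (ℕₚ.+-mono-≤ m≤a m≤a)) 2a+1≤2m))

module _ (m : ℕ) where

  record HoleRow (c : Fin (suc (m + m))) : Set where
    field
      row : Row
      fits : Fits (m + m) row
      hole : rowKind (m + m) row (toℕ c) ≡ just deleted
      only-hole : ∀ y κ → rowKind (m + m) row y ≡ just κ → y ≡ toℕ c × κ ≡ deleted

  holeRow : ∀ c → HoleRow c
  holeRow c with parity (toℕ c)
  ... | a , inj₁ c≡2a with split-even m a (subst (_≤ m + m) c≡2a (ℕₚ.≤-pred (Finₚ.toℕ<n c)))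
  ... | b , fits = record
    { row = linear (oneHole a deleted b)
    ; fits = trans (totalWidth-oneHole a deleted b) (cong suc fits)
    ; hole = trans (cong (kindAt (oneHole a deleted b)) c≡2a) (kindAt-oneHole a deleted b)
    ; only-hole = λ y κ e → let y≡ , κ≡ = kindAt-oneHole⁻¹ a deleted b y κ e in trans y≡ (sym c≡2a) , κ≡ }
  holeRow c | a , inj₂ c≡2a+1 with split-odd m a (subst (_≤ m + m) c≡2a+1 (ℕₚ.≤-pred (Finₚ.toℕ<n c)))
  ... | b , fits = record
    { row = wrapped (oneHole a deleted b)
    ; fits = trans (cong suc (totalWidth-oneHole a deleted b)) fits
    ; hole = trans (cong (wrappedKind (m + m) (oneHole a deleted b)) c≡2a+1) (wrappedHole-kind m a deleted b fits)
    ; only-hole = λ y κ e → let y≡ , κ≡ = wrappedHole-kind⁻¹ m a deleted b y κ e in trans y≡ (sym c≡2a+1) , κ≡ }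

  -- Two deleted vertices in different rows: each of their rows gets a single deleted hole.
  module OtherRowPlan (c : Fin (suc (m + m))) (r₀ : Fin 4) (r₀≢0 : r₀ ≢ zero) where

    private
      open HoleRow (holeRow c) using (row; only-hole)
      rowAt : ∀ r → Dec (r ≡ r₀) → Row
      rowAt zero _ = deletedRow m
      rowAt (suc _) (yes _) = row
      rowAt (suc _) (no _) = halves
      rows : Fin 4 → Row
      rows r = rowAt r (r Fin.≟ r₀)
      fits : ∀ r d → Fits (m + m) (rowAt r d)
      fits zero _ = totalWidth-oneHole 0 deleted m
      fits (suc _) (yes _) = HoleRow.fits (holeRow c)
      fits (suc _) (no _) = tt
      hole-at : ∀ r → r ≡ r₀ → (d : Dec (r ≡ r₀)) → rowKind (m + m) (rowAt r d) (toℕ c) ≡ just deleted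
      hole-at zero refl _ = contradiction refl r₀≢0
      hole-at (suc _) _ (yes _) = HoleRow.hole (holeRow c)
      hole-at (suc _) r≡r₀ (no r≢r₀) = contradiction r≡r₀ r≢r₀
      kind⁻¹ : ∀ (v : Vertex (m + m)) κ → kind rows v ≡ just κ → (v ≡ origin ⊎ v ≡ (c , r₀)) × κ ≡ deleted
      kind⁻¹ (x , r) κ = cases r (r Fin.≟ r₀)
        where
        cases : ∀ r (d : Dec (r ≡ r₀)) → rowKind (m + m) (rowAt r d) (toℕ x) ≡ just κ → ((x , r) ≡ origin ⊎ (x , r) ≡ (c , r₀)) × κ ≡ deleted
        cases zero _ e with deletedRow-kind⁻¹ m x κ e
        ... | refl , κ≡ = inj₁ refl , κ≡
        cases (suc _) (yes refl) e with only-hole (toℕ x) κ e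
        ... | x≡c , κ≡ = inj₂ (cong (_, _) (Finₚ.toℕ-injective x≡c)) , κ≡

    origin-otherRow-HasFPM : HasFPM (suc (m + m)) 4 (origin ∷ (c , r₀) ∷ []) []
    origin-otherRow-HasFPM = PlanHasFPM {m + m} rows record
      { fits = λ r → fits r (r Fin.≟ r₀)
      ; up-down = λ u e → case proj₂ (kind⁻¹ u up e) of λ ()
      ; down-up = λ u e → case proj₂ (kind⁻¹ (above u) down e) of λ ()
      ; deleted-sound = λ { _ (here refl) → deletedRow-kind m ; _ (there (here refl)) → hole-at r₀ refl (r₀ Fin.≟ r₀) ; _ (there (there ())) }
      ; deleted-complete = λ v e → case proj₁ (kind⁻¹ v deleted e) of λ { (inj₁ v≡) → here v≡ ; (inj₂ v≡) → there (here v≡) }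
      ; right-deleted = λ _ ()
      ; above-deleted = λ _ () }

  open OtherRowPlan public using (origin-otherRow-HasFPM)

  -- Two deleted vertices in the same row, an even distance 2a+2 apart: the cells between them are
  -- matched with the row above, whose remaining cells wrap around the seam.
  module EvenGapPlan (a b : ℕ) (fits : suc (suc (a + a + (b + b))) ≡ m + m) (c : Fin (suc (m + m))) (c≡ : toℕ c ≡ suc (suc (a + a))) where

    private
      row₀ row₁ : List Segment
      row₀ = holes deleted 1 ∷ holes up (suc (a + a)) ∷ holes deleted 1 ∷ pairs b ∷ []
      row₁ = holes down (suc (a + a)) ∷ pairs b ∷ []
      rows : Fin 4 → Row
      rows zero = linear row₀
      rows (suc zero) = wrapped row₁
      rows (suc (suc _)) = halves
      row₀-kind⁻¹ : ∀ y κ → kindAt row₀ y ≡ just κ →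
        (y ≡ 0 × κ ≡ deleted) ⊎ (1 ≤ y × y < suc (suc (a + a)) × κ ≡ up) ⊎ (y ≡ suc (suc (a + a)) × κ ≡ deleted)
      row₀-kind⁻¹ y κ e with kindAt⁻¹ row₀ y κ e
      ... | _ , _ , here refl , o≤y , y<o+1 , refl = inj₁ (single-cell o≤y y<o+1 , refl)
      ... | _ , _ , there (here refl) , 1≤y , y<2a+2 , refl = inj₂ (inj₁ (1≤y , y<2a+2 , refl))
      ... | _ , _ , there (there (here refl)) , o≤y , y<o+1 , refl = inj₂ (inj₂ (single-cell o≤y y<o+1 , refl))
      ... | _ , _ , there (there (there (here refl))) , _ , _ , ()
      row₁-kind⁻¹ : ∀ y κ → wrappedKind (m + m) row₁ y ≡ just κ → ∃ λ y′ → y ≡ suc y′ × y′ < suc (a + a) × κ ≡ down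
      row₁-kind⁻¹ y κ e with wrappedKind⁻¹ (m + m) row₁ y κ e
      ... | y′ , refl , e′ with kindAt⁻¹ row₁ y′ κ e′
      ... | _ , _ , here refl , _ , y′< , refl = y′ , refl , y′< , refl
      ... | _ , _ , there (here refl) , _ , _ , ()
      up-at : ∀ y → 1 ≤ y → y < suc (suc (a + a)) → kindAt row₀ y ≡ just up
      up-at y 1≤y y< = kindAt-placement row₀ y (there (here refl)) 1≤y y<
      down-at : ∀ y′ → y′ < suc (a + a) → wrappedKind (m + m) row₁ (suc y′) ≡ just down
      down-at y′ y′< = trans (wrappedKind-inside (m + m) row₁ y′ (ℕₚ.≤-trans (s≤s y′<)
          (subst (suc (suc (a + a)) ≤_) fits (s≤s (s≤s (ℕₚ.m≤m+n (a + a) (b + b)))))))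
        (kindAt-placement row₁ y′ (here refl) z≤n y′<)
      second-deleted : kindAt row₀ (toℕ c) ≡ just deleted
      second-deleted = trans (cong (kindAt row₀) c≡) (kindAt-placement row₀ (suc (suc (a + a))) (there (there (here refl)))
        ℕₚ.≤-refl (subst (suc (suc (a + a)) <_) (ℕₚ.+-comm 1 (suc (suc (a + a)))) (ℕₚ.n<1+n _)))
      up-down : ∀ u → kind rows u ≡ just up → kind rows (above u) ≡ just down
      up-down (x , zero) e with row₀-kind⁻¹ (toℕ x) up e
      ... | inj₂ (inj₁ (1≤x , x< , _)) = down-above (toℕ x) 1≤x x<
        where
        down-above : ∀ y → 1 ≤ y → y < suc (suc (a + a)) → wrappedKind (m + m) row₁ y ≡ just down
        down-above (suc y′) _ y< = down-at y′ (ℕₚ.≤-pred y<)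
      ... | inj₁ (_ , ())
      ... | inj₂ (inj₂ (_ , ()))
      up-down (x , suc zero) e = case proj₂ (proj₂ (proj₂ (row₁-kind⁻¹ (toℕ x) up e))) of λ ()
      down-up : ∀ u → kind rows (above u) ≡ just down → kind rows u ≡ just up
      down-up (x , zero) e with row₁-kind⁻¹ (toℕ x) down e
      ... | y′ , x≡ , y′< , _ = trans (cong (kindAt row₀) x≡) (up-at (suc y′) (s≤s z≤n) (s≤s y′<))
      down-up (x , suc (suc (suc zero))) e with row₀-kind⁻¹ (toℕ x) down e
      ... | inj₁ (_ , ())
      ... | inj₂ (inj₁ (_ , _ , ()))
      ... | inj₂ (inj₂ (_ , ()))
      deleted-complete : ∀ v → kind rows v ≡ just deleted → v ∈ origin ∷ (c , zero) ∷ []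
      deleted-complete (x , zero) e with row₀-kind⁻¹ (toℕ x) deleted e
      ... | inj₁ (x≡0 , _) = here (cong (_, zero) (Finₚ.toℕ-injective {j = zero} x≡0))
      ... | inj₂ (inj₁ (_ , _ , ()))
      ... | inj₂ (inj₂ (x≡ , _)) = there (here (cong (_, zero) (Finₚ.toℕ-injective (trans x≡ (sym c≡)))))
      deleted-complete (x , suc zero) e = case proj₂ (proj₂ (proj₂ (row₁-kind⁻¹ (toℕ x) deleted e))) of λ ()

    origin-evenGap-HasFPM : HasFPM (suc (m + m)) 4 (origin ∷ (c , zero) ∷ []) []
    origin-evenGap-HasFPM = PlanHasFPM {m + m} rows record
      { fits = λ { zero → cong suc (trans (cong (λ k → suc (a + a) + suc k) (ℕₚ.+-identityʳ (b + b)))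
                                          (trans (ℕₚ.+-suc (suc (a + a)) (b + b)) fits))
                 ; (suc zero) → trans (cong (λ k → suc (suc (a + a) + k)) (ℕₚ.+-identityʳ (b + b))) fits
                 ; (suc (suc _)) → tt }
      ; up-down = up-down
      ; down-up = down-up
      ; deleted-sound = λ { _ (here refl) → refl ; _ (there (here refl)) → second-deleted ; _ (there (there ())) }
      ; deleted-complete = deleted-complete
      ; right-deleted = λ _ ()
      ; above-deleted = λ _ () }

  open EvenGapPlan public using (origin-evenGap-HasFPM)

  -- Two deleted vertices in the same row, an odd distance 2a+1 apart: the cells after the second one
  -- are matched with the row above.
  module OddGapPlan (a b : ℕ) (fits : suc (suc (a + a + (b + b))) ≡ m + m) (c : Fin (suc (m + m))) (c≡ : toℕ c ≡ suc (a + a)) where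

    private
      row₀ row₁ : List Segment
      row₀ = holes deleted 1 ∷ pairs a ∷ holes deleted 1 ∷ holes up (suc (b + b)) ∷ []
      row₁ = pairs (suc a) ∷ holes down (suc (b + b)) ∷ []
      rows : Fin 4 → Row
      rows zero = linear row₀
      rows (suc zero) = linear row₁
      rows (suc (suc _)) = halves
      row₁-width : suc (suc (a + a)) + suc (b + b) ≡ suc (m + m)
      row₁-width = trans (ℕₚ.+-suc (suc (suc (a + a))) (b + b)) (cong suc fits)
      row₀-kind⁻¹ : ∀ y κ → kindAt row₀ y ≡ just κ →
        (y ≡ 0 × κ ≡ deleted) ⊎ (y ≡ suc (a + a) × κ ≡ deleted) ⊎ (suc (suc (a + a)) ≤ y × κ ≡ up)
      row₀-kind⁻¹ y κ e with kindAt⁻¹ row₀ y κ e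
      ... | _ , _ , here refl , o≤y , y<o+1 , refl = inj₁ (single-cell o≤y y<o+1 , refl)
      ... | _ , _ , there (here refl) , _ , _ , ()
      ... | _ , _ , there (there (here refl)) , o≤y , y<o+1 , refl = inj₂ (inj₁ (single-cell o≤y y<o+1 , refl))
      ... | _ , _ , there (there (there (here refl))) , o≤y , _ , refl =
        inj₂ (inj₂ (subst (_≤ y) (ℕₚ.+-comm (suc (a + a)) 1) o≤y , refl))
      row₁-kind⁻¹ : ∀ y κ → kindAt row₁ y ≡ just κ → suc a + suc a ≤ y × κ ≡ down
      row₁-kind⁻¹ y κ e with kindAt⁻¹ row₁ y κ e
      ... | _ , _ , here refl , _ , _ , ()
      ... | _ , _ , there (here refl) , o≤y , _ , refl = o≤y , refl
      up-at : ∀ y → suc (suc (a + a)) ≤ y → y < suc (m + m) → kindAt row₀ y ≡ just up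
      up-at y o≤y y< = kindAt-placement row₀ y (there (there (there (here refl)))) (subst (_≤ y) (ℕₚ.+-comm 1 (suc (a + a))) o≤y)
        (subst (y <_) (sym (trans (cong (_+ suc (b + b)) (ℕₚ.+-comm (suc (a + a)) 1)) row₁-width)) y<)
      down-at : ∀ y → suc (suc (a + a)) ≤ y → y < suc (m + m) → kindAt row₁ y ≡ just down
      down-at y o≤y y< = kindAt-placement row₁ y (there (here refl)) (subst (_≤ y) (sym (double-suc a)) o≤y)
        (subst (y <_) (sym (trans (cong (_+ suc (b + b)) (double-suc a)) row₁-width)) y<)
      second-deleted : kindAt row₀ (toℕ c) ≡ just deleted
      second-deleted = trans (cong (kindAt row₀) c≡) (kindAt-placement row₀ (suc (a + a)) (there (there (here refl)))
        ℕₚ.≤-refl (subst (suc (a + a) <_) (ℕₚ.+-comm 1 (suc (a + a))) (ℕₚ.n<1+n _)))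
      up-down : ∀ u → kind rows u ≡ just up → kind rows (above u) ≡ just down
      up-down (x , zero) e with row₀-kind⁻¹ (toℕ x) up e
      ... | inj₁ (_ , ())
      ... | inj₂ (inj₁ (_ , ()))
      ... | inj₂ (inj₂ (o≤x , _)) = down-at (toℕ x) o≤x (Finₚ.toℕ<n x)
      up-down (x , suc zero) e = case proj₂ (row₁-kind⁻¹ (toℕ x) up e) of λ ()
      down-up : ∀ u → kind rows (above u) ≡ just down → kind rows u ≡ just up
      down-up (x , zero) e = up-at (toℕ x) (subst (_≤ toℕ x) (double-suc a) (proj₁ (row₁-kind⁻¹ (toℕ x) down e))) (Finₚ.toℕ<n x)
      down-up (x , suc (suc (suc zero))) e with row₀-kind⁻¹ (toℕ x) down e
      ... | inj₁ (_ , ())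
      ... | inj₂ (inj₁ (_ , ()))
      ... | inj₂ (inj₂ (_ , ()))
      deleted-complete : ∀ v → kind rows v ≡ just deleted → v ∈ origin ∷ (c , zero) ∷ []
      deleted-complete (x , zero) e with row₀-kind⁻¹ (toℕ x) deleted e
      ... | inj₁ (x≡0 , _) = here (cong (_, zero) (Finₚ.toℕ-injective {j = zero} x≡0))
      ... | inj₂ (inj₁ (x≡ , _)) = there (here (cong (_, zero) (Finₚ.toℕ-injective (trans x≡ (sym c≡)))))
      ... | inj₂ (inj₂ (_ , ()))
      deleted-complete (x , suc zero) e = case proj₂ (row₁-kind⁻¹ (toℕ x) deleted e) of λ ()

    origin-oddGap-HasFPM : HasFPM (suc (m + m)) 4 (origin ∷ (c , zero) ∷ []) []
    origin-oddGap-HasFPM = PlanHasFPM {m + m} rows record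
      { fits = λ { zero → cong suc (trans (cong (λ k → a + a + suc k) (ℕₚ.+-identityʳ (suc (b + b))))
                                          (trans (ℕₚ.+-suc (a + a) (suc (b + b))) (trans (cong suc (ℕₚ.+-suc (a + a) (b + b))) fits)))
                 ; (suc zero) → trans (cong₂ _+_ (double-suc a) (ℕₚ.+-identityʳ (suc (b + b)))) row₁-width
                 ; (suc (suc _)) → tt }
      ; up-down = up-down
      ; down-up = down-up
      ; deleted-sound = λ { _ (here refl) → refl ; _ (there (here refl)) → second-deleted ; _ (there (there ())) }
      ; deleted-complete = deleted-complete
      ; right-deleted = λ _ ()
      ; above-deleted = λ _ () }

  open OddGapPlan public using (origin-oddGap-HasFPM)

-- At most two deleted vertices and edges, or three deleted edges

module _ (m : ℕ) (1≤m : 1 ≤ m) where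

  private
    column≤m+m : ∀ (x : Fin (suc (m + m))) → toℕ x ≤ m + m
    column≤m+m x = ℕₚ.≤-pred (Finₚ.toℕ<n x)

    rightEdge-only : ∀ {p u : Vertex (m + m)} → Deleted (rightEdge p ∷ []) u (right u) → u ≡ p
    rightEdge-only (here uv) = rightEdge-right (2≤m+m m 1≤m) uv

    rightEdge-no-above : ∀ {p : Vertex (m + m)} u → ¬ Deleted (rightEdge p ∷ []) u (above u)
    rightEdge-no-above u (here uv) = rightEdge-above uv

  origin-aboveEdge-HasFPM : ∀ q → HasFPM (suc (m + m)) 4 (origin ∷ []) (aboveEdge q ∷ [])
  origin-aboveEdge-HasFPM q = origin-HasFPM m λ { u (here uv) → ⊥-elim (aboveEdge-right uv) }

  origin-rightEdge-HasFPM : ∀ q → HasFPM (suc (m + m)) 4 (origin ∷ []) (rightEdge q ∷ [])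
  origin-rightEdge-HasFPM (x , r) with parity (toℕ x)
  ... | a , inj₁ x≡2a = even r
    where
    unused : ∀ κ → matchedAt (oneHole 0 κ m) (toℕ x) ≡ 0
    unused κ = trans (cong (matchedAt (oneHole 0 κ m)) x≡2a) (matchedAt-hole-first m κ a)
    even : ∀ r → HasFPM (suc (m + m)) 4 (origin ∷ []) (rightEdge (x , r) ∷ [])
    even zero = origin-HasFPM m λ u del → case rightEdge-only del of λ { refl → refl , unused deleted }
    even (suc zero) = origin-pair₁₂-HasFPM m 0 m refl
      (λ u del → case rightEdge-only del of λ { refl → inj₁ refl , unused }) rightEdge-no-above
    even (suc (suc zero)) = origin-pair₁₂-HasFPM m 0 m refl
      (λ u del → case rightEdge-only del of λ { refl → inj₂ refl , unused }) rightEdge-no-above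
    even (suc (suc (suc zero))) = origin-pair₂₃-HasFPM m 0 m refl
      (λ u del → case rightEdge-only del of λ { refl → inj₂ refl , unused }) rightEdge-no-above
  ... | a , inj₂ x≡2a+1 = odd r
    where
    unused : ∀ κ → matchedAt (oneHole m κ 0) (toℕ x) ≡ 0
    unused κ = trans (cong (matchedAt (oneHole m κ 0)) x≡2a+1) (matchedAt-hole-last m κ a (subst (_≤ m + m) x≡2a+1 (column≤m+m x)))
    fits : m + m + (0 + 0) ≡ m + m
    fits = ℕₚ.+-identityʳ (m + m)
    odd : ∀ r → HasFPM (suc (m + m)) 4 (origin ∷ []) (rightEdge (x , r) ∷ [])
    odd zero with split-odd m a (subst (_≤ m + m) x≡2a+1 (column≤m+m x))
    ... | b , fits₀ = origin-oddEdge-HasFPM m a b fits₀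
      (λ u del → case rightEdge-only del of λ { refl → refl , x≡2a+1 }) rightEdge-no-above
    odd (suc zero) = origin-pair₁₂-HasFPM m m 0 fits
      (λ u del → case rightEdge-only del of λ { refl → inj₁ refl , unused }) rightEdge-no-above
    odd (suc (suc zero)) = origin-pair₁₂-HasFPM m m 0 fits
      (λ u del → case rightEdge-only del of λ { refl → inj₂ refl , unused }) rightEdge-no-above
    odd (suc (suc (suc zero))) = origin-pair₂₃-HasFPM m m 0 fits
      (λ u del → case rightEdge-only del of λ { refl → inj₂ refl , unused }) rightEdge-no-above

  origin-vertex-HasFPM : ∀ q → q ≢ origin → HasFPM (suc (m + m)) 4 (origin ∷ q ∷ []) []
  origin-vertex-HasFPM (c , suc r) _ = origin-otherRow-HasFPM m c (suc r) (λ ())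
  origin-vertex-HasFPM (c , zero) q≢o with parity (toℕ c)
  ... | zero , inj₁ c≡0 = contradiction (cong (_, zero) (Finₚ.toℕ-injective {j = zero} c≡0)) q≢o
  ... | suc a , inj₁ c≡2a+2 with split-odd m a (ℕₚ.≤-trans (ℕₚ.n≤1+n _) (subst (_≤ m + m) (trans c≡2a+2 (double-suc a)) (column≤m+m c)))
  ... | b , fits = origin-evenGap-HasFPM m a b fits c (trans c≡2a+2 (double-suc a))
  origin-vertex-HasFPM (c , zero) q≢o | a , inj₂ c≡2a+1 with split-odd m a (subst (_≤ m + m) c≡2a+1 (column≤m+m c))
  ... | b , fits = origin-oddGap-HasFPM m a b fits c c≡2a+1

  private
    from-origin : ∀ p {De} → HasFPM (suc (m + m)) 4 (origin ∷ []) De → ∀ i j → translate i j p ≡ origin →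
      HasFPM (suc (m + m)) 4 (map (translate i j) (p ∷ [])) De
    from-origin p fpm i j τp≡o = subst (λ v → HasFPM (suc (m + m)) 4 (v ∷ []) _) (sym τp≡o) fpm

  vertex-HasFPM : ∀ p → HasFPM (suc (m + m)) 4 (p ∷ []) []
  vertex-HasFPM p with translate-to-origin p
  ... | i , j , τp≡o = HasFPM-translate i j (λ _ _ ()) (from-origin p (origin-HasFPM m {[]} (λ _ ())) i j τp≡o)

  vertex-edge-HasFPM : ∀ p e → HasFPM (suc (m + m)) 4 (p ∷ []) (e ∷ [])
  vertex-edge-HasFPM p e with translate-to-origin p | Edge⇒right⊎above e
  ... | i , j , τp≡o | inj₁ (q , e⊆) = HasFPM-translate i j
    (λ { u w (here uw) → here (rightEdge-translate i j q u w (⊆ₑ-endpoints e⊆ u w uw)) })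
    (from-origin p (origin-rightEdge-HasFPM (translate i j q)) i j τp≡o)
  ... | i , j , τp≡o | inj₂ (q , e⊆) = HasFPM-translate i j
    (λ { u w (here uw) → here (aboveEdge-translate i j q u w (⊆ₑ-endpoints e⊆ u w uw)) })
    (from-origin p (origin-aboveEdge-HasFPM (translate i j q)) i j τp≡o)

  twoVertices-HasFPM : ∀ p q → p ≢ q → HasFPM (suc (m + m)) 4 (p ∷ q ∷ []) []
  twoVertices-HasFPM p q p≢q with translate-to-origin p
  ... | i , j , τp≡o = HasFPM-translate i j (λ _ _ ())
    (subst (λ v → HasFPM (suc (m + m)) 4 (v ∷ translate i j q ∷ []) []) (sym τp≡o)
      (origin-vertex-HasFPM (translate i j q) (λ τq≡o → p≢q (translate-injective i j (trans τp≡o (sym τq≡o))))))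

  fsmp-lower : ∀ (F : DelSet (suc (m + m)) 4) → size F < 3 → ¬ Destroys F
  fsmp-lower (delSet [] es _ _) size<3 destroys = destroys (edges-HasFPM m 1≤m es (ℕₚ.≤-trans (ℕₚ.≤-pred size<3) (ℕₚ.n≤1+n 2)))
  fsmp-lower (delSet (p ∷ []) [] _ _) _ destroys = destroys (vertex-HasFPM p)
  fsmp-lower (delSet (p ∷ []) (e ∷ []) _ _) _ destroys = destroys (vertex-edge-HasFPM p e)
  fsmp-lower (delSet (p ∷ q ∷ []) [] ((p≢q ∷ []) ∷ _) _) _ destroys = destroys (twoVertices-HasFPM p q p≢q)
  fsmp-lower (delSet (p ∷ []) (e ∷ e′ ∷ es) _ _) (s≤s (s≤s (s≤s ())))
  fsmp-lower (delSet (p ∷ q ∷ []) (e ∷ es) _ _) (s≤s (s≤s (s≤s ())))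
  fsmp-lower (delSet (p ∷ q ∷ r ∷ vs) es _ _) (s≤s (s≤s (s≤s ())))

  fmp-lower : ∀ (F : DelSet (suc (m + m)) 4) → DelSet.verts F ≡ [] → size F < 4 → ¬ Destroys F
  fmp-lower (delSet [] es _ _) refl size<4 destroys = destroys (edges-HasFPM m 1≤m es (ℕₚ.≤-pred size<4))



-- Sets destroying every fractional perfect matching

sign : ℕ → ℚ
sign zero = 1ℚ
sign (suc zero) = - 1ℚ
sign (suc (suc k)) = sign k

sign-suc : ∀ k → sign k +ℚ sign (suc k) ≡ 0ℚ
sign-suc zero = refl
sign-suc (suc zero) = refl
sign-suc (suc (suc k)) = sign-suc k

sign-even : ∀ a → sign (a + a) ≡ 1ℚ
sign-even zero = refl
sign-even (suc a) = trans (cong sign (double-suc a)) (sign-even a)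

sign-odd : ∀ a → sign (suc (a + a)) ≡ - 1ℚ
sign-odd zero = refl
sign-odd (suc a) = trans (cong (sign ∘ ℕ.suc) (double-suc a)) (sign-odd a)

sign-period : ∀ t → sign t +ℚ (sign (suc t) +ℚ (sign t +ℚ (sign (suc t) +ℚ 0ℚ))) ≡ 0ℚ
sign-period zero = refl
sign-period (suc zero) = refl
sign-period (suc (suc t)) = sign-period t

≡0⇒≥0 : ∀ {q} → q ≡ 0ℚ → 0ℚ ≤ℚ q
≡0⇒≥0 refl = ℚₚ.≤-refl

module _ (m : ℕ) (1≤m : 1 ≤ m) where

  isolatingEdges : List (Edge (suc (m + m)) 4)
  isolatingEdges = rightEdge origin ∷ rightEdge (left origin) ∷ aboveEdge origin ∷ aboveEdge (below origin) ∷ []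

  isolatingEdges-destroy : ¬ HasFPM (suc (m + m)) 4 [] isolatingEdges
  isolatingEdges-destroy = isolated⇒¬HasFPM origin (λ ()) isolated
    where
    isolated : ∀ w → ¬ Alive (suc (m + m)) 4 [] isolatingEdges origin w
    isolated w (ow , _ , _ , ¬del) with Adj⇒neighbours origin w ow
    ... | inj₁ w≡ = ¬del (here (inj₁ (refl , sym w≡)))
    ... | inj₂ (inj₁ o≡) = ¬del (there (here (inj₂ (trans (cong left o≡) (left-right w) , right-left origin))))
    ... | inj₂ (inj₂ (inj₁ w≡)) = ¬del (there (there (here (inj₁ (refl , sym w≡)))))
    ... | inj₂ (inj₂ (inj₂ o≡)) = ¬del (there (there (there (here (inj₂ (trans (cong below o≡) (below-above w) , above-below origin))))))

  isolatingEdges-distinct : AllPairs (λ e f → ¬ SameEdge e f) isolatingEdges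
  isolatingEdges-distinct =
    (right-left-distinct ∷ rightEdge-above ∷ rightEdge-above ∷ []) ∷ (rightEdge-above ∷ rightEdge-above ∷ []) ∷
    (above-below-distinct ∷ []) ∷ [] ∷ []
    where
    right-left-distinct : ¬ IsEdge (rightEdge origin) (left origin) (right (left origin))
    right-left-distinct uv = ℕₚ.<⇒≢ (ℕₚ.<-≤-trans (s≤s z≤n) (2≤m+m m 1≤m))
      (sym (trans (sym toℕ-predᶜ-zero) (cong (toℕ ∘ proj₁) (rightEdge-right (2≤m+m m 1≤m) uv))))
    above-below-distinct : ¬ IsEdge (aboveEdge origin) (below origin) (above (below origin))
    above-below-distinct uv = case cong proj₂ (aboveEdge-above uv) of λ ()

  firstColumn : Fin 4 → ℚ
  firstColumn zero = 0ℚ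
  firstColumn (suc zero) = - 1ℚ
  firstColumn (suc (suc zero)) = 1ℚ
  firstColumn (suc (suc (suc zero))) = - 1ℚ

  -- Outside the first column the barrier is a ±1 chessboard, which every edge there balances; in the first
  -- column the pattern is reversed and the only unbalanced edges are the deleted ones.
  barrier : Vertex (m + m) → ℚ
  barrier (zero , r) = firstColumn r
  barrier (suc x , r) = sign (toℕ r + toℕ x)

  barrierEdges : List (Edge (suc (m + m)) 4)
  barrierEdges = rightEdge (zero , suc zero) ∷ rightEdge (zero , suc (suc (suc zero))) ∷ []

  barrier-sum : ∑ᵥ barrier ≡ - 1ℚ
  barrier-sum = trans (cong (∑[ r < 4 ] firstColumn r +ℚ_) (∑-zero (m + m) _ (λ x → sign-period (toℕ x))))
                      (ℚₚ.+-identityʳ (- 1ℚ))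

  private
    Live : Vertex (m + m) → Vertex (m + m) → Set
    Live = Alive (suc (m + m)) 4 (origin ∷ []) barrierEdges

    barrier-step : ∀ x (y : Fin (suc (m + m))) r → toℕ y ≡ suc (toℕ x) → (x , r) ∉ origin ∷ [] →
      ¬ Deleted barrierEdges (x , r) (right (x , r)) → 0ℚ ≤ℚ barrier (x , r) +ℚ barrier (y , r)
    barrier-step zero (suc y) zero _ o∉ _ = contradiction (here refl) o∉
    barrier-step zero (suc y) (suc zero) _ _ ¬del = contradiction (here (inj₁ (refl , refl))) ¬del
    barrier-step zero (suc y) (suc (suc zero)) y≡ _ _ rewrite ℕₚ.suc-injective y≡ = ℚₚ.nonNegative⁻¹ (1ℚ +ℚ 1ℚ)
    barrier-step zero (suc y) (suc (suc (suc zero))) _ _ ¬del = contradiction (there (here (inj₁ (refl , refl)))) ¬del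
    barrier-step (suc x) (suc y) r y≡ _ _ rewrite ℕₚ.suc-injective y≡ | ℕₚ.+-suc (toℕ r) (toℕ x) =
      ≡0⇒≥0 (sign-suc (toℕ r + toℕ x))

    barrier-wrap : ∀ (x : Fin (suc (m + m))) r → toℕ x ≡ m + m → (zero {m + m} , r) ∉ origin ∷ [] → 0ℚ ≤ℚ barrier (x , r) +ℚ firstColumn r
    barrier-wrap zero r 0≡n _ = contradiction 0≡n (ℕₚ.<⇒≢ (ℕₚ.<-≤-trans (s≤s z≤n) (2≤m+m m 1≤m)))
    barrier-wrap (suc x) r x≡n o∉ with parity (toℕ x)
    ... | a , inj₁ x≡2a = contradiction (trans (cong suc (sym x≡2a)) x≡n) (odd≢even a m)
    ... | a , inj₂ x≡2a+1 rewrite x≡2a+1 = by-row r o∉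
      where
      by-row : ∀ r → (zero {m + m} , r) ∉ origin ∷ [] → 0ℚ ≤ℚ sign (toℕ r + suc (a + a)) +ℚ firstColumn r
      by-row zero o∉ = contradiction (here refl) o∉
      by-row (suc zero) _ rewrite sign-even a = ℚₚ.≤-refl
      by-row (suc (suc zero)) _ rewrite sign-odd a = ℚₚ.≤-refl
      by-row (suc (suc (suc zero))) _ rewrite sign-even a = ℚₚ.≤-refl

    barrier-right : ∀ u → Live u (right u) → 0ℚ ≤ℚ barrier u +ℚ barrier (right u)
    barrier-right (x , r) (_ , u∉ , w∉ , ¬del) with toℕ-sucᶜ-cases x
    ... | inj₁ step = barrier-step x (sucᶜ x) r step u∉ ¬del
    ... | inj₂ (x≡n , wrap) rewrite wrap = barrier-wrap x r x≡n w∉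

    barrier-above : ∀ u → Live u (above u) → 0ℚ ≤ℚ barrier u +ℚ barrier (above u)
    barrier-above (zero , zero) (_ , u∉ , _) = contradiction (here refl) u∉
    barrier-above (zero , suc zero) _ = ℚₚ.≤-refl
    barrier-above (zero , suc (suc zero)) _ = ℚₚ.≤-refl
    barrier-above (zero , suc (suc (suc zero))) (_ , _ , w∉ , _) = contradiction (here refl) w∉
    barrier-above (suc x , zero) _ = ≡0⇒≥0 (sign-suc (toℕ x))
    barrier-above (suc x , suc zero) _ = ≡0⇒≥0 (sign-suc (suc (toℕ x)))
    barrier-above (suc x , suc (suc zero)) _ = ≡0⇒≥0 (sign-suc (toℕ x))
    barrier-above (suc x , suc (suc (suc zero))) _ = ≡0⇒≥0 (trans (ℚₚ.+-comm (sign (suc (toℕ x))) (sign (toℕ x))) (sign-suc (toℕ x)))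

    barrier-alive : ∀ u w → Live u w → 0ℚ ≤ℚ barrier u +ℚ barrier w
    barrier-alive u w alive with Adj⇒neighbours u w (proj₁ alive)
    ... | inj₁ refl = barrier-right u alive
    ... | inj₂ (inj₁ refl) = subst (0ℚ ≤ℚ_) (ℚₚ.+-comm (barrier w) (barrier u)) (barrier-right w (Alive-sym u w alive))
    ... | inj₂ (inj₂ (inj₁ refl)) = barrier-above u alive
    ... | inj₂ (inj₂ (inj₂ refl)) = subst (0ℚ ≤ℚ_) (ℚₚ.+-comm (barrier w) (barrier u)) (barrier-above w (Alive-sym u w alive))

  barrier-destroy : ¬ HasFPM (suc (m + m)) 4 (origin ∷ []) barrierEdges
  barrier-destroy = certificate⇒¬HasFPM barrier (λ { _ (here refl) → refl }) barrier-alive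
    (subst (_<ℚ 0ℚ) (sym barrier-sum) (ℚₚ.negative⁻¹ (- 1ℚ)))

  barrierEdges-distinct : AllPairs (λ e f → ¬ SameEdge e f) barrierEdges
  barrierEdges-distinct = ((λ uv → case cong proj₂ (rightEdge-right (2≤m+m m 1≤m) uv) of λ ()) ∷ []) ∷ [] ∷ []

fsmp-fmp : ∀ m → 1 ≤ m → FsmpIs (suc (m + m)) 4 3 × FmpIs (suc (m + m)) 4 4
fsmp-fmp m 1≤m =
  ((delSet (origin ∷ []) (barrierEdges m 1≤m) ([] ∷ []) (barrierEdges-distinct m 1≤m) , refl , barrier-destroy m 1≤m) ,
   fsmp-lower m 1≤m) ,
  ((delSet [] (isolatingEdges m 1≤m) [] (isolatingEdges-distinct m 1≤m) , refl , refl , isolatingEdges-destroy m 1≤m) ,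
   fmp-lower m 1≤m)

lemma4p9 : (k1 : ℕ) → 3 ≤ k1 → Odd k1 → FsmpIs k1 4 3 × FmpIs k1 4 4
lemma4p9 _ (s≤s ()) (zero , refl)
lemma4p9 _ _ (suc m , refl) =
  subst (λ k → FsmpIs k 4 3 × FmpIs k 4 4) (cong (λ t → suc (suc m + t)) (sym (ℕₚ.+-identityʳ (suc m))))
    (fsmp-fmp (suc m) (s≤s z≤n))
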